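{- Let $\pi,\tau\in S_n$ with $d(\pi,\tau)=t$, and let $\lambda=\lambda(\pi)$, $\mu=\lambda(\tau)$. Then every block $B$ of the pair $(\lambda,\mu)$ satisfies $A(B)\le t$, where $A(B)$ is the number of cells of $B$.
   Context: For $\sigma\in S_n$, $\lambda(\sigma)=(\lambda_1\ge\lambda_2\ge\cdots)$ is the RSK shape of $\sigma$ (the common shape of the insertion and recording tableaux), a partition of $n$ identified with its Young diagram, with $\lambda_i=0$ for $i$ beyond its number of parts. $d(\pi,\tau)$ is the least number of adjacent transpositions $(i,i+1)$ by which one must successively left-multiply $\pi$ (replacing $\sigma$ by $(i,i+1)\circ\sigma$) to obtain $\tau$. Blocks: a row index $j$ is a $\lambda$-row if $\lambda_j>\mu_j$ and a $\mu$-row if $\mu_j>\lambda_j$. A $\lambda$-block is the set of cells of $\lambda\setminus\mu$ lying in the rows of a maximal interval $I$ of consecutive row indices such that $\lambda_j\ge\mu_j$ for all $j\in I$ and $I$ contains at least one $\lambda$-row (equivalently, a maximal collection of consecutive maximal runs of $\lambda$-rows not separated by any $\mu$-row); $\mu$-blocks are defined in the same way with the roles of $\lambda$ and $\mu$ exchanged. A block is a $\lambda$-block or a $\mu$-block; the blocks partition the symmetric difference of the diagrams $\lambda$ and $\mu$. -}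

module Defs where

open import Data.Nat using (ℕ; zero; suc; _+_; _∸_; _≤_; _<_; _≤ᵇ_)
open import Data.Bool using (Bool; true; false; if_then_else_)
open import Data.Fin using (Fin; toℕ)
open import Data.Fin.Permutation using (Permutation′; _⟨$⟩ʳ_; _∘ₚ_; transpose; _≈_)
open import Data.List using (List; []; _∷_; map; length; _++_; upTo; foldl; applyUpTo; concatMap)
open import Data.List.Base using (allFin)
open import Data.Product using (Σ; ∃; _×_; _,_)
open import Data.Sum using (_⊎_)
open import Relation.Nullary using (¬_)
open import Relation.Binary.PropositionalEquality using (_≡_)

-- One-line notation of σ ∈ S_n (values 0..n-1; shifting all values by
-- one does not change the RSK shape).

word : ∀ {n} → Permutation′ n → List ℕ
word {n} σ = map (λ k → toℕ (σ ⟨$⟩ʳ k)) (allFin n)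

-- Robinson–Schensted insertion.  A tableau is a list of rows (top row
-- first), each row a strictly increasing list.

Tableau : Set
Tableau = List (List ℕ)

rowInsert : ℕ → List ℕ → List ℕ × (ℕ ⊎ Data.Bool.Bool)
rowInsert x [] = (x ∷ []) , Data.Sum.inj₂ true
rowInsert x (y ∷ ys) with suc x ≤ᵇ y
... | true  = (x ∷ ys) , Data.Sum.inj₁ y
... | false with rowInsert x ys
...   | (ys' , r) = (y ∷ ys') , r

insertT : ℕ → Tableau → Tableau
insertT x [] = (x ∷ []) ∷ []
insertT x (row ∷ rows) with rowInsert x row
... | (row' , Data.Sum.inj₁ z) = row' ∷ insertT z rows
... | (row' , Data.Sum.inj₂ _) = row' ∷ rows

insertionTableau : List ℕ → Tableau
insertionTableau = foldl (λ T x → insertT x T) []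

shape : ∀ {n} → Permutation′ n → List ℕ
shape σ = map length (insertionTableau (word σ))

-- λ_j (rows indexed from 0), with λ_j = 0 beyond the number of parts.
part : List ℕ → ℕ → ℕ
part []       _       = 0
part (x ∷ _)  zero    = x
part (_ ∷ xs) (suc j) = part xs j

-- s_i ∘ σ with s_i = (i, i+1), i.e. the permutation k ↦ s_i (σ k).
-- (_∘ₚ_ is diagrammatic: (σ ∘ₚ ρ) k = ρ (σ k).)
-- Steps m π τ : τ is obtained from π by successively left-multiplying
-- by m adjacent transpositions.
data Steps {n : ℕ} : ℕ → Permutation′ n → Permutation′ n → Set where
  done : ∀ {π τ} → π ≈ τ → Steps zero π τ
  step : ∀ {m π τ} (i j : Fin n) → toℕ j ≡ suc (toℕ i) →
         Steps m (π ∘ₚ transpose i j) τ → Steps (suc m) π τ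

Distance : ∀ {n} → Permutation′ n → Permutation′ n → ℕ → Set
Distance π τ t = Steps t π τ × (∀ m → m < t → ¬ Steps m π τ)

-- Rows are indexed 0,1,2,…
-- (the paper's row j+1 is our row j).  An interval of rows is [a, b).
-- Since λ, μ ⊢ n have at most n parts, all rows ≥ n have λ_j = μ_j = 0;
-- the maximal interval is therefore truncated at n, which does not
-- change the set of cells of the block.

record IsLBlock (n : ℕ) (lam mu : List ℕ) (a b : ℕ) : Set where
  field
    a≤b      : a ≤ b
    b≤n      : b ≤ n
    dominate : ∀ j → a ≤ j → j < b → part mu j ≤ part lam j
    hasRow   : ∃ λ j → a ≤ j × j < b × part mu j < part lam j
    leftMax  : a ≡ 0 ⊎ ∃ λ a' → a ≡ suc a' × part lam a' < part mu a'
    rightMax : b ≡ n ⊎ (b < n × part lam b < part mu b)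

cells : List ℕ → List ℕ → ℕ → ℕ → List (ℕ × ℕ)
cells lam mu a b =
  concatMap (λ j → applyUpTo (λ k → (j , part mu j + k)) (part lam j ∸ part mu j))
            (applyUpTo (a +_) (b ∸ a))

data Block (n : ℕ) (lam mu : List ℕ) : Set where
  lblock : ∀ a b → IsLBlock n lam mu a b → Block n lam mu
  mblock : ∀ a b → IsLBlock n mu lam a b → Block n lam mu

blockCells : ∀ {n lam mu} → Block n lam mu → List (ℕ × ℕ)
blockCells {lam = lam} {mu} (lblock a b _) = cells lam mu a b
blockCells {lam = lam} {mu} (mblock a b _) = cells mu lam a b

A : ∀ {n lam mu} → Block n lam mu → ℕ
A B = length (blockCells B)

module Submission where

-- Write Λ_k ν = ν₁ + ⋯ + ν_k.  Coverable k is invariant under Knuth moves,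
--     Schensted insertion yields a tableau Knuth equivalent to the word, and
--     for tableaux one colours by rows (lower bound) and peels off the first
--     column (upper bound);
--  3. exchanging the values x, x+1 of a word (= left multiplication by an
--     adjacent transposition) changes Λ_k by at most one, monotonically, so
--     every band of rows [a, b) gains or loses at most one cell (BandExcess);
--  4. excesses add up along the t steps, and on the rows of a block, where one
--     shape dominates the other, the band excess counts the block's cells.

open import Defs
open import Data.Nat using (ℕ; _≤_)
open import Data.Fin.Permutation using (Permutation′)

open import Data.Bool using (Bool; true; false; T)
open import Data.Empty using (⊥; ⊥-elim)
open import Data.Fin using (Fin; toℕ)
import Data.Fin.Properties as Fin
open import Data.Fin.Permutation using (_⟨$⟩ʳ_; _⟨$⟩ˡ_; _∘ₚ_; transpose; _≈_; inverseˡ; inverseʳ)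
import Data.Fin.Permutation.Components as PermutationComponents
open import Data.List using (List; []; _∷_; _++_; map; length; foldl; take; drop; allFin; applyUpTo; concatMap)
open import Data.List.Membership.Propositional using (_∈_)
open import Data.List.Membership.Propositional.Properties using (∈-∃++; ∈-++⁺ʳ; ∈-map⁺; ∈-allFin)
open import Data.List.Properties
  using (++-assoc; ++-identityʳ; map-++; length-++; ∷-injective; take-map; drop-map; map-∘; map-cong;
         applyUpTo-∷ʳ; length-applyUpTo)
open import Data.List.Relation.Ternary.Interleaving.Propositional using (Interleaving; consˡ; consʳ; swap; [])
import Data.List.Relation.Ternary.Interleaving.Properties as Interleaving
open import Data.List.Relation.Unary.All as All using (All; []; _∷_)
import Data.List.Relation.Unary.All.Properties as All
open import Data.List.Relation.Unary.AllPairs using (AllPairs; []; _∷_)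
import Data.List.Relation.Unary.AllPairs.Properties as AllPairs
open import Data.List.Relation.Unary.Any using (here; there)
open import Data.List.Relation.Unary.Unique.Propositional using (Unique)
import Data.List.Relation.Unary.Unique.Propositional.Properties as Unique
open import Data.Nat using (zero; suc; _+_; _∸_; _<_; z≤n; s≤s; _≟_; _≤ᵇ_)
open import Data.Nat.ListAction using (sum)
open import Data.Nat.ListAction.Properties using (sum-++)
open import Data.Nat.Properties
open import Algebra.Properties.CommutativeSemigroup +-commutativeSemigroup using (interchange)
open import Data.Nat.Solver using (module +-*-Solver)
open +-*-Solver using (solve; _:+_; _:=_)
open import Data.Product using (Σ; _×_; _,_; proj₁; proj₂; uncurry) renaming (swap to ×-swap)
open import Data.Sum using (_⊎_; inj₁; inj₂)
open import Data.Unit using (⊤; tt)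
open import Function using (_∘_)
open import Function.Bundles using (_⇔_; mk⇔; Equivalence)
open import Function.Construct.Composition using (_⇔-∘_)
open import Function.Construct.Identity using (⇔-id)
open import Function.Construct.Symmetry using (⇔-sym)
open import Relation.Nullary using (yes; no)
open import Relation.Binary.PropositionalEquality
  using (_≡_; _≢_; refl; sym; trans; cong; cong₂; subst; subst₂; module ≡-Reasoning)

allPairs-++⁻ : ∀ {R : ℕ → ℕ → Set} xs {ys} → AllPairs R (xs ++ ys) →
  AllPairs R xs × AllPairs R ys × All (λ x → All (R x) ys) xs
allPairs-++⁻ []       rys        = [] , rys , []
allPairs-++⁻ (x ∷ xs) (rx ∷ rxs) with allPairs-++⁻ xs rxs
... | rxs′ , rys , cross = All.++⁻ˡ xs rx ∷ rxs′ , rys , All.++⁻ʳ xs rx ∷ cross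

Increasing : List ℕ → Set
Increasing = AllPairs _<_

below-trans : ∀ {us : List ℕ} {a b} → All (_< a) us → a < b → All (_< b) us
below-trans us<a a<b = All.map (λ u<a → <-trans u<a a<b) us<a
above-trans : ∀ {vs : List ℕ} {a b} → a < b → All (b <_) vs → All (a <_) vs
above-trans a<b b<vs = All.map (<-trans a<b) b<vs

below-above : ∀ {us vs : List ℕ} {m} → All (_< m) us → All (m <_) vs →
  All (λ u → All (u <_) vs) us
below-above us<m m<vs = All.map (λ u<m → above-trans u<m m<vs) us<m

inc-mid⁻ : ∀ us {vs : List ℕ} {m} → Increasing (us ++ m ∷ vs) →
  Increasing us × All (_< m) us × All (m <_) vs × Increasing vs
inc-mid⁻ us inc with allPairs-++⁻ us inc
... | inc-us , (m<vs ∷ inc-vs) , cross = inc-us , All.map All.head cross , m<vs , inc-vs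
inc-mid⁺ : ∀ {us vs : List ℕ} {m} → Increasing us → All (_< m) us →
  All (m <_) vs → Increasing vs → Increasing (us ++ m ∷ vs)
inc-mid⁺ inc-us us<m m<vs inc-vs =
  AllPairs.++⁺ inc-us (m<vs ∷ inc-vs) (All.map (λ u<m → u<m ∷ above-trans u<m m<vs) us<m)

inc-delete : ∀ us {vs : List ℕ} {m} → Increasing (us ++ m ∷ vs) → Increasing (us ++ vs)
inc-delete us inc with inc-mid⁻ us inc
... | inc-us , us<m , m<vs , inc-vs = AllPairs.++⁺ inc-us inc-vs (below-above us<m m<vs)

lower-second : ∀ us {vs x y z} → x < y → y < z →
  Increasing (us ++ x ∷ z ∷ vs) → Increasing (us ++ x ∷ y ∷ vs)
lower-second us x<y y<z inc with inc-mid⁻ us inc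
... | inc-us , us<x , (_ ∷ x<vs) , (z<vs ∷ inc-vs) =
  inc-mid⁺ inc-us us<x (x<y ∷ x<vs) (above-trans y<z z<vs ∷ inc-vs)
raise-first : ∀ us {vs x y z} → x < y → y < z →
  Increasing (us ++ x ∷ z ∷ vs) → Increasing (us ++ y ∷ z ∷ vs)
raise-first us x<y y<z inc with inc-mid⁻ us inc
... | inc-us , us<x , _ , (z<vs ∷ inc-vs) =
  inc-mid⁺ inc-us (below-trans us<x x<y) (y<z ∷ above-trans y<z z<vs) (z<vs ∷ inc-vs)

Decreasing : List ℕ → Set
Decreasing = AllPairs (λ a b → b < a)

monotone-both : ∀ w → Increasing w → Decreasing w → length w ≤ 1
monotone-both []          _                  _                  = z≤n
monotone-both (a ∷ [])    _                  _                  = s≤s z≤n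
monotone-both (a ∷ b ∷ w) ((a<b ∷ _) ∷ _) ((b<a ∷ _) ∷ _) = ⊥-elim (<-asym a<b b<a)

-- Colour 0 means
-- "not selected", colour j+1 means "in the j-th chosen subsequence", so a
-- coloured word describes a family of disjoint subsequences of its letters.
Coloured : Set
Coloured = List (ℕ × ℕ)

letters : Coloured → List ℕ
letters = map proj₁

pick : ℕ → ℕ × ℕ → List ℕ
pick j (a , c) with c ≟ j
... | yes _ = a ∷ []
... | no  _ = []
cls : ℕ → Coloured → List ℕ
cls j []       = []
cls j (e ∷ cw) = pick j e ++ cls j cw

pick-yes : ∀ j a → pick j (a , j) ≡ a ∷ []
pick-yes j a with j ≟ j
... | yes _ = refl
... | no j≢j = ⊥-elim (j≢j refl)
pick-no : ∀ j {c} a → c ≢ j → pick j (a , c) ≡ []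
pick-no j {c} a c≢j with c ≟ j
... | yes c≡j = ⊥-elim (c≢j c≡j)
... | no  _   = refl

cls-++ : ∀ j cw cw′ → cls j (cw ++ cw′) ≡ cls j cw ++ cls j cw′
cls-++ j []       cw′ = refl
cls-++ j (e ∷ cw) cw′ = trans (cong (pick j e ++_) (cls-++ j cw cw′)) (sym (++-assoc (pick j e) _ _))

weight : Coloured → ℕ
weight []                = 0
weight ((_ , zero) ∷ cw)  = weight cw
weight ((_ , suc _) ∷ cw) = suc (weight cw)

weight-++ : ∀ cw cw′ → weight (cw ++ cw′) ≡ weight cw + weight cw′
weight-++ []                 cw′ = refl
weight-++ ((_ , zero) ∷ cw)  cw′ = weight-++ cw cw′
weight-++ ((_ , suc _) ∷ cw) cw′ = cong suc (weight-++ cw cw′)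

IsColouring : ℕ → Coloured → Set
IsColouring k cw = All (λ e → proj₂ e ≤ k) cw × (∀ j → Increasing (cls (suc j) cw))

-- Coverable k w s: at least s letters of w can be covered by k disjoint
-- increasing subsequences.  Greene's theorem identifies the maximal such s.
Coverable : ℕ → List ℕ → ℕ → Set
Coverable k w s = Σ Coloured λ cw → letters cw ≡ w × IsColouring k cw × s ≤ weight cw

cls-all : ∀ {P : ℕ → Set} j cw → All P (letters cw) → All P (cls j cw)
cls-all j []             _          = []
cls-all j ((a , c) ∷ cw) (pa ∷ ps) with c ≟ j
... | yes _ = pa ∷ cls-all j cw ps
... | no  _ = cls-all j cw ps
cls-allPairs : ∀ {R : ℕ → ℕ → Set} j cw → AllPairs R (letters cw) → AllPairs R (cls j cw)
cls-allPairs j []             _           = []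
cls-allPairs j ((a , c) ∷ cw) (ra ∷ rs) with c ≟ j
... | yes _ = cls-all j cw ra ∷ cls-allPairs j cw rs
... | no  _ = cls-allPairs j cw rs

weight≤length : ∀ cw → weight cw ≤ length (letters cw)
weight≤length []                 = z≤n
weight≤length ((_ , zero)  ∷ cw) = m≤n⇒m≤1+n (weight≤length cw)
weight≤length ((_ , suc _) ∷ cw) = s≤s (weight≤length cw)

split : ∀ u {r} cw → letters cw ≡ u ++ r →
  Σ Coloured λ cu → Σ Coloured λ cr → cw ≡ cu ++ cr × letters cu ≡ u × letters cr ≡ r
split []      cw       e = [] , cw , refl , refl , e
split (a ∷ u) (e ∷ cw) eq with ∷-injective eq
... | refl , eq′ with split u cw eq′
... | cu , cr , refl , refl , refl = e ∷ cu , cr , refl , refl , refl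
uncons : ∀ {a r} cw → letters cw ≡ a ∷ r →
  Σ ℕ λ c → Σ Coloured λ cr → cw ≡ (a , c) ∷ cr × letters cr ≡ r
uncons ((a , c) ∷ cw) refl = c , cw , refl , refl

letters-window : ∀ cu m cv → letters (cu ++ m ++ cv) ≡ letters cu ++ letters m ++ letters cv
letters-window cu m cv = trans (map-++ proj₁ cu _) (cong (letters cu ++_) (map-++ proj₁ m cv))

splitWindow : ∀ u m v cw → letters cw ≡ u ++ m ++ v →
  Σ Coloured λ cu → Σ Coloured λ cm → Σ Coloured λ cv →
    cw ≡ cu ++ cm ++ cv × letters cu ≡ u × letters cm ≡ m × letters cv ≡ v
splitWindow u m v cw e with split u cw e
... | cu , cr , refl , lu , lr with split m cr lr
... | cm , cv , refl , lm , lv = cu , cm , cv , refl , lu , lm , lv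

splitMarked : ∀ u m v p q cw → letters cw ≡ u ++ p ∷ m ++ q ∷ v →
  Σ Coloured λ cu → Σ ℕ λ c₁ → Σ Coloured λ cm → Σ ℕ λ c₂ → Σ Coloured λ cv →
    cw ≡ cu ++ (p , c₁) ∷ cm ++ (q , c₂) ∷ cv × letters cu ≡ u × letters cm ≡ m × letters cv ≡ v
splitMarked u m v p q cw e with split u cw e
... | cu , r₁ , refl , lu , l₁ with uncons r₁ l₁
... | c₁ , r₂ , refl , l₂ with split m r₂ l₂
... | cm , r₃ , refl , lm , l₃ with uncons r₃ l₃
... | c₂ , cv , refl , lv = cu , c₁ , cm , c₂ , cv , refl , lu , lm , lv

letters-marked : ∀ cu cm cv a b c₁ c₂ →
  letters (cu ++ (a , c₁) ∷ cm ++ (b , c₂) ∷ cv) ≡ letters cu ++ a ∷ letters cm ++ b ∷ letters cv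
letters-marked cu cm cv a b c₁ c₂ =
  trans (map-++ proj₁ cu _) (cong (λ w → letters cu ++ a ∷ w) (map-++ proj₁ cm _))

cls-window : ∀ j cu m cv → cls j (cu ++ m ++ cv) ≡ cls j cu ++ cls j m ++ cls j cv
cls-window j cu m cv = trans (cls-++ j cu _) (cong (cls j cu ++_) (cls-++ j m cv))
cls-two : ∀ j cu a cm b cv →
  cls j (cu ++ a ∷ cm ++ b ∷ cv) ≡ cls j cu ++ pick j a ++ cls j cm ++ pick j b ++ cls j cv
cls-two j cu a cm b cv rewrite cls-++ j cu (a ∷ cm ++ b ∷ cv) | cls-++ j cm (b ∷ cv) = refl

windowClass : ∀ {k} cu m cv → IsColouring k (cu ++ m ++ cv) →
  ∀ j → Increasing (cls (suc j) cu ++ cls (suc j) m ++ cls (suc j) cv)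
windowClass cu m cv (_ , inc) j = subst Increasing (cls-window (suc j) cu m cv) (inc j)
fromWindowClasses : ∀ {k} cu m cv → All (λ e → proj₂ e ≤ k) (cu ++ m ++ cv) →
  (∀ j → Increasing (cls (suc j) cu ++ cls (suc j) m ++ cls (suc j) cv)) →
  IsColouring k (cu ++ m ++ cv)
fromWindowClasses cu m cv bounded inc =
  bounded , λ j → subst Increasing (sym (cls-window (suc j) cu m cv)) (inc j)

weight-parts : ∀ cu cu′ m m′ cv cv′ → weight cu ≡ weight cu′ → weight m ≡ weight m′ →
  weight cv ≡ weight cv′ → weight (cu ++ m ++ cv) ≡ weight (cu′ ++ m′ ++ cv′)
weight-parts cu cu′ m m′ cv cv′ eu em ev = begin
  weight (cu ++ m ++ cv)                ≡⟨ weight-++ cu _ ⟩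
  weight cu + weight (m ++ cv)          ≡⟨ cong (weight cu +_) (weight-++ m cv) ⟩
  weight cu + (weight m + weight cv)    ≡⟨ cong₂ _+_ eu (cong₂ _+_ em ev) ⟩
  weight cu′ + (weight m′ + weight cv′) ≡⟨ cong (weight cu′ +_) (weight-++ m′ cv′) ⟨
  weight cu′ + weight (m′ ++ cv′)       ≡⟨ weight-++ cu′ _ ⟨
  weight (cu′ ++ m′ ++ cv′)             ∎
  where open ≡-Reasoning

reweigh : ∀ {s} cu {m m′} cv → weight m ≡ weight m′ →
  s ≤ weight (cu ++ m ++ cv) → s ≤ weight (cu ++ m′ ++ cv)
reweigh cu {m} {m′} cv eq = subst (_ ≤_) (weight-parts cu cu m m′ cv cv refl eq refl)

-- Weight only depends on the multiset of colours, not on the letters.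
weight-swap : ∀ e₁ e₂ r → weight (e₁ ∷ e₂ ∷ r) ≡ weight (e₂ ∷ e₁ ∷ r)
weight-swap (_ , zero)  (_ , zero)  r = refl
weight-swap (_ , zero)  (_ , suc _) r = refl
weight-swap (_ , suc _) (_ , zero)  r = refl
weight-swap (_ , suc _) (_ , suc _) r = refl
weight-cons : ∀ e {r r′} → weight r ≡ weight r′ → weight (e ∷ r) ≡ weight (e ∷ r′)
weight-cons (_ , zero)  eq = eq
weight-cons (_ , suc _) eq = cong suc eq
weight-relabel : ∀ cu {a a′} c {r r′} → weight r ≡ weight r′ →
  weight (cu ++ (a , c) ∷ r) ≡ weight (cu ++ (a′ , c) ∷ r′)
weight-relabel cu {a} {a′} c {r} {r′} eq = weight-parts cu cu ((a , c) ∷ []) ((a′ , c) ∷ []) r r′ refl (single c) eq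
  where
  single : ∀ c → weight ((a , c) ∷ []) ≡ weight ((a′ , c) ∷ [])
  single zero    = refl
  single (suc _) = refl

weight-unselect : ∀ cu {a} c cv → weight (cu ++ (a , suc c) ∷ cv) ≡ suc (weight (cu ++ (a , 0) ∷ cv))
weight-unselect cu c cv = trans (weight-++ cu _) (trans (+-suc (weight cu) _) (cong suc (sym (weight-++ cu _))))

snoc-assoc : ∀ {X : Set} (xs : List X) x ys → xs ++ x ∷ ys ≡ (xs ++ x ∷ []) ++ ys
snoc-assoc xs x ys = sym (++-assoc xs (x ∷ []) ys)

covering : ∀ {k s} cu m cv → IsColouring k (cu ++ m ++ cv) → s ≤ weight (cu ++ m ++ cv) →
  Coverable k (letters cu ++ letters m ++ letters cv) s
covering cu m cv valid s≤w = cu ++ m ++ cv , letters-window cu m cv , valid , s≤w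

-- The transposition of ℕ exchanging c and d.  It renames colours below,
-- and it is the action of a transposition on the values of a permutation.
exchange : ℕ → ℕ → ℕ → ℕ
exchange c d e with e ≟ c
... | yes _ = d
... | no _ with e ≟ d
...   | yes _ = c
...   | no _  = e

exchange-left : ∀ c d → exchange c d c ≡ d
exchange-left c d with c ≟ c
... | yes _ = refl
... | no c≢c = ⊥-elim (c≢c refl)
exchange-right : ∀ c d → exchange c d d ≡ c
exchange-right c d with d ≟ c
... | yes d≡c = d≡c
... | no _ with d ≟ d
...   | yes _ = refl
...   | no d≢d = ⊥-elim (d≢d refl)
exchange-other : ∀ {c d e} → e ≢ c → e ≢ d → exchange c d e ≡ e
exchange-other {c} {d} {e} e≢c e≢d with e ≟ c
... | yes e≡c = ⊥-elim (e≢c e≡c)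
... | no _ with e ≟ d
...   | yes e≡d = ⊥-elim (e≢d e≡d)
...   | no _ = refl
exchange-involutive : ∀ c d e → exchange c d (exchange c d e) ≡ e
exchange-involutive c d e with e ≟ c
... | yes refl = exchange-right e d
... | no e≢c with e ≟ d
...   | yes refl = exchange-left c e
...   | no e≢d = exchange-other e≢c e≢d

recolour : ℕ → ℕ → Coloured → Coloured
recolour c d = map (λ (a , e) → a , exchange c d e)

letters-recolour : ∀ c d cw → letters (recolour c d cw) ≡ letters cw
letters-recolour c d []       = refl
letters-recolour c d (e ∷ cw) = cong (proj₁ e ∷_) (letters-recolour c d cw)

cls-recolour : ∀ c d j cw → cls j (recolour c d cw) ≡ cls (exchange c d j) cw
cls-recolour c d j [] = refl
cls-recolour c d j ((a , e) ∷ cw) = cong₂ _++_ pick-exchange (cls-recolour c d j cw)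
  where
  pick-exchange : pick j (a , exchange c d e) ≡ pick (exchange c d j) (a , e)
  pick-exchange with exchange c d e ≟ j | e ≟ exchange c d j
  ... | yes _ | yes _ = refl
  ... | no  _ | no  _ = refl
  ... | yes p | no  q = ⊥-elim (q (trans (sym (exchange-involutive c d e)) (cong (exchange c d) p)))
  ... | no  p | yes q = ⊥-elim (p (trans (cong (exchange c d) q) (exchange-involutive c d j)))

weight-recolour : ∀ c d cw → weight (recolour (suc c) (suc d) cw) ≡ weight cw
weight-recolour c d [] = refl
weight-recolour c d ((a , e) ∷ cw) with e ≟ suc c
... | yes refl = cong suc (weight-recolour c d cw)
... | no e≢c with e ≟ suc d
...   | yes refl = cong suc (weight-recolour c d cw)
weight-recolour c d ((a , zero)  ∷ cw) | no _ | no _ = weight-recolour c d cw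
weight-recolour c d ((a , suc _) ∷ cw) | no _ | no _ = cong suc (weight-recolour c d cw)

bounded-recolour : ∀ {k} c d cw → c ≤ k → d ≤ k →
  All (λ e → proj₂ e ≤ k) cw → All (λ e → proj₂ e ≤ k) (recolour c d cw)
bounded-recolour c d [] c≤k d≤k [] = []
bounded-recolour c d ((a , e) ∷ cw) c≤k d≤k (e≤k ∷ bs) =
  exchange-bounded ∷ bounded-recolour c d cw c≤k d≤k bs
  where
  exchange-bounded : exchange c d e ≤ _
  exchange-bounded with e ≟ c
  ... | yes _ = d≤k
  ... | no _ with e ≟ d
  ...   | yes _ = c≤k
  ...   | no _  = e≤k

reweigh-prefix : ∀ {s} cu {m m′} cv c d → weight m ≡ weight m′ →
  s ≤ weight (cu ++ m ++ cv) → s ≤ weight (recolour (suc c) (suc d) cu ++ m′ ++ cv)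
reweigh-prefix cu {m} {m′} cv c d eq =
  subst (_ ≤_) (weight-parts cu (recolour (suc c) (suc d) cu) m m′ cv cv (sym (weight-recolour c d cu)) eq refl)
reweigh-suffix : ∀ {s} cu {m m′} cv c d → weight m ≡ weight m′ →
  s ≤ weight (cu ++ m ++ cv) → s ≤ weight (cu ++ m′ ++ recolour (suc c) (suc d) cv)
reweigh-suffix cu {m} {m′} cv c d eq =
  subst (_ ≤_) (weight-parts cu cu m m′ cv (recolour (suc c) (suc d) cv) refl eq (sym (weight-recolour c d cv)))

Apart : ℕ → ℕ → Set
Apart c₁ c₂ = ∀ j → c₁ ≡ suc j → c₂ ≡ suc j → ⊥

apart? : ∀ c₁ c₂ → Apart c₁ c₂ ⊎ Σ ℕ λ c → c₁ ≡ suc c × c₂ ≡ suc c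
apart? zero    c₂       = inj₁ λ _ ()
apart? (suc c) zero     = inj₁ λ _ _ ()
apart? (suc c) (suc c′) with c ≟ c′
... | yes refl  = inj₂ (c , refl , refl)
... | no  c≢c′ = inj₁ λ { _ refl refl → c≢c′ refl }

suc≢ : ∀ {c j} → c ≢ j → suc c ≢ suc j
suc≢ c≢j refl = c≢j refl

inversion-apart : ∀ {k} cu {a} cm {b} cv {c₁ c₂} →
  IsColouring k (cu ++ (a , c₁) ∷ cm ++ (b , c₂) ∷ cv) → b < a → Apart c₁ c₂
inversion-apart cu {a} cm {b} cv (_ , inc) b<a j refl refl with inc j
... | class rewrite cls-two (suc j) cu (a , suc j) cm (b , suc j) cv | pick-yes (suc j) a | pick-yes (suc j) b
  with inc-mid⁻ (cls (suc j) cu) class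
... | _ , _ , a<rest , _ = <-asym b<a (All.head (All.++⁻ʳ (cls (suc j) cm) a<rest))

swap-apart : ∀ {k} cu e₁ e₂ cv → Apart (proj₂ e₁) (proj₂ e₂) →
  IsColouring k (cu ++ e₁ ∷ e₂ ∷ cv) → IsColouring k (cu ++ e₂ ∷ e₁ ∷ cv)
swap-apart cu e₁ e₂ cv apart valid@(bounded , _) =
  fromWindowClasses cu (e₂ ∷ e₁ ∷ []) cv bounded′ λ j →
    subst (λ L → Increasing (cls (suc j) cu ++ L ++ cls (suc j) cv)) (commute j e₁ e₂ apart)
      (windowClass cu (e₁ ∷ e₂ ∷ []) cv valid j)
  where
  bounded′ : All _ (cu ++ e₂ ∷ e₁ ∷ cv)
  bounded′ with All.++⁻ cu bounded
  ... | bu , b₁ ∷ b₂ ∷ bv = All.++⁺ bu (b₂ ∷ b₁ ∷ bv)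
  commute : ∀ j e₁ e₂ → Apart (proj₂ e₁) (proj₂ e₂) →
    cls (suc j) (e₁ ∷ e₂ ∷ []) ≡ cls (suc j) (e₂ ∷ e₁ ∷ [])
  commute j (a , c₁) (b , c₂) apart with c₁ ≟ suc j | c₂ ≟ suc j
  ... | yes e₁ | yes e₂ = ⊥-elim (apart j e₁ e₂)
  ... | yes _  | no _   = refl
  ... | no _   | yes _  = refl
  ... | no _   | no _   = refl

coverable-sort : ∀ {k s} u {a b} v → b < a →
  Coverable k (u ++ a ∷ b ∷ v) s → Coverable k (u ++ b ∷ a ∷ v) s
coverable-sort u {a} {b} v b<a (cw , e , valid , s≤w)
  with splitWindow u (a ∷ b ∷ []) v cw e
... | cu , (_ , c₁) ∷ (_ , c₂) ∷ [] , cv , refl , refl , refl , refl =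
  covering cu ((b , c₂) ∷ (a , c₁) ∷ []) cv
    (swap-apart cu _ _ cv (inversion-apart cu [] cv valid b<a) valid)
    (reweigh cu cv (weight-swap (a , c₁) (b , c₂) []) s≤w)

-- The four colourings needed for the Knuth move x z y ↦ z x y, and for
-- y x z ↦ y z x (x < y < z), when the two letters being exchanged share the
-- colour C = suc c.  If the third letter is unselected it takes over the
-- role of one of them; if it has another colour D, colours C and D are
-- exchanged on the far side of the window.
--
-- x z y ↦ z x y with y unselected: y replaces z in the subsequence C.
knuth₁-unselected : ∀ {k} cu cv {x y z} c → x < y → y < z →
  IsColouring k (cu ++ (x , suc c) ∷ (z , suc c) ∷ (y , 0) ∷ cv) →
  IsColouring k (cu ++ (z , 0) ∷ (x , suc c) ∷ (y , suc c) ∷ cv)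
knuth₁-unselected cu cv {x} {y} {z} c x<y y<z valid@(bounded , _) =
  fromWindowClasses cu m′ cv bounded′ classes
  where
  C = suc c
  m m′ : Coloured
  m  = (x , C) ∷ (z , C) ∷ (y , 0) ∷ []
  m′ = (z , 0) ∷ (x , C) ∷ (y , C) ∷ []
  bounded′ : All _ (cu ++ m′ ++ cv)
  bounded′ with All.++⁻ cu bounded
  ... | bu , bx ∷ _ ∷ _ ∷ bv = All.++⁺ bu (z≤n ∷ bx ∷ bx ∷ bv)
  classes : ∀ j → Increasing (cls (suc j) cu ++ cls (suc j) m′ ++ cls (suc j) cv)
  classes j with j ≟ c | windowClass cu m cv valid j
  ... | yes refl | old rewrite pick-yes C x | pick-yes C z | pick-yes C y =
    lower-second (cls C cu) x<y y<z old
  ... | no j≢c | old rewrite pick-no (suc j) x (suc≢ (j≢c ∘ sym)) | pick-no (suc j) z (suc≢ (j≢c ∘ sym))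
                           | pick-no (suc j) y (suc≢ (j≢c ∘ sym)) = old

-- x z y ↦ z x y with y of colour D: the subsequence C becomes
-- (C-part before the window) x y (D-part after it), and D symmetrically.
knuth₁-exchange : ∀ {k} cu cv {x y z} c d → x < y → y < z → c ≢ d →
  IsColouring k (cu ++ (x , suc c) ∷ (z , suc c) ∷ (y , suc d) ∷ cv) →
  IsColouring k (cu ++ (z , suc d) ∷ (x , suc c) ∷ (y , suc c) ∷ recolour (suc c) (suc d) cv)
knuth₁-exchange cu cv {x} {y} {z} c d x<y y<z c≢d valid@(bounded , _) =
  fromWindowClasses cu m′ (recolour C D cv) bounded′ classes
  where
  C = suc c
  D = suc d
  m m′ : Coloured
  m  = (x , C) ∷ (z , C) ∷ (y , D) ∷ []
  m′ = (z , D) ∷ (x , C) ∷ (y , C) ∷ []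
  bounded′ : All _ (cu ++ m′ ++ recolour C D cv)
  bounded′ with All.++⁻ cu bounded
  ... | bu , bx ∷ _ ∷ by ∷ bv = All.++⁺ bu (by ∷ bx ∷ bx ∷ bounded-recolour C D cv bx by bv)
  D≢C : D ≢ C
  D≢C = suc≢ (c≢d ∘ sym)
  oldC : Increasing (cls C cu ++ x ∷ z ∷ cls C cv)
  oldC with windowClass cu m cv valid c
  ... | old rewrite pick-yes C x | pick-yes C z | pick-no C y D≢C = old
  oldD : Increasing (cls D cu ++ y ∷ cls D cv)
  oldD with windowClass cu m cv valid d
  ... | old rewrite pick-no D x (D≢C ∘ sym) | pick-no D z (D≢C ∘ sym) | pick-yes D y = old
  classes : ∀ j → Increasing (cls (suc j) cu ++ cls (suc j) m′ ++ cls (suc j) (recolour C D cv))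
  classes j rewrite cls-recolour C D (suc j) cv with j ≟ c | j ≟ d
  ... | yes refl | yes refl = ⊥-elim (c≢d refl)
  ... | yes refl | no _ rewrite exchange-left C D | pick-no C z D≢C | pick-yes C x | pick-yes C y
    with inc-mid⁻ (cls C cu) oldC | inc-mid⁻ (cls D cu) oldD
  ... | inc-u , u<x , _ , _ | _ , _ , y<v , inc-v =
    inc-mid⁺ inc-u u<x (x<y ∷ above-trans x<y y<v) (y<v ∷ inc-v)
  classes j | no _ | yes refl rewrite exchange-right C D | pick-yes D z | pick-no D x (D≢C ∘ sym)
                                    | pick-no D y (D≢C ∘ sym)
    with inc-mid⁻ (cls C cu) oldC | inc-mid⁻ (cls D cu) oldD
  ... | _ , _ , _ , (z<v ∷ inc-v) | inc-u , u<y , _ , _ =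
    inc-mid⁺ inc-u (below-trans u<y y<z) z<v inc-v
  classes j | no j≢c | no j≢d
    rewrite exchange-other (suc≢ j≢c) (suc≢ j≢d) | pick-no (suc j) z (suc≢ (j≢d ∘ sym))
          | pick-no (suc j) x (suc≢ (j≢c ∘ sym)) | pick-no (suc j) y (suc≢ (j≢c ∘ sym))
    with windowClass cu m cv valid j
  ... | old rewrite pick-no (suc j) x (suc≢ (j≢c ∘ sym)) | pick-no (suc j) z (suc≢ (j≢c ∘ sym))
                  | pick-no (suc j) y (suc≢ (j≢d ∘ sym)) = old

-- y x z ↦ y z x with y unselected: y replaces x in the subsequence C.
knuth₂-unselected : ∀ {k} cu cv {x y z} c → x < y → y < z →
  IsColouring k (cu ++ (y , 0) ∷ (x , suc c) ∷ (z , suc c) ∷ cv) →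
  IsColouring k (cu ++ (y , suc c) ∷ (z , suc c) ∷ (x , 0) ∷ cv)
knuth₂-unselected cu cv {x} {y} {z} c x<y y<z valid@(bounded , _) =
  fromWindowClasses cu m′ cv bounded′ classes
  where
  C = suc c
  m m′ : Coloured
  m  = (y , 0) ∷ (x , C) ∷ (z , C) ∷ []
  m′ = (y , C) ∷ (z , C) ∷ (x , 0) ∷ []
  bounded′ : All _ (cu ++ m′ ++ cv)
  bounded′ with All.++⁻ cu bounded
  ... | bu , _ ∷ bx ∷ _ ∷ bv = All.++⁺ bu (bx ∷ bx ∷ z≤n ∷ bv)
  classes : ∀ j → Increasing (cls (suc j) cu ++ cls (suc j) m′ ++ cls (suc j) cv)
  classes j with j ≟ c | windowClass cu m cv valid j
  ... | yes refl | old rewrite pick-yes C x | pick-yes C z | pick-yes C y =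
    raise-first (cls C cu) x<y y<z old
  ... | no j≢c | old rewrite pick-no (suc j) x (suc≢ (j≢c ∘ sym)) | pick-no (suc j) z (suc≢ (j≢c ∘ sym))
                           | pick-no (suc j) y (suc≢ (j≢c ∘ sym)) = old

-- y x z ↦ y z x with y of colour D: the subsequence C becomes
-- (D-part before the window) y z (C-part after it), and D symmetrically.
knuth₂-exchange : ∀ {k} cu cv {x y z} c d → x < y → y < z → c ≢ d →
  IsColouring k (cu ++ (y , suc d) ∷ (x , suc c) ∷ (z , suc c) ∷ cv) →
  IsColouring k (recolour (suc c) (suc d) cu ++ (y , suc c) ∷ (z , suc c) ∷ (x , suc d) ∷ cv)
knuth₂-exchange cu cv {x} {y} {z} c d x<y y<z c≢d valid@(bounded , _) =
  fromWindowClasses (recolour C D cu) m′ cv bounded′ classes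
  where
  C = suc c
  D = suc d
  m m′ : Coloured
  m  = (y , D) ∷ (x , C) ∷ (z , C) ∷ []
  m′ = (y , C) ∷ (z , C) ∷ (x , D) ∷ []
  bounded′ : All _ (recolour C D cu ++ m′ ++ cv)
  bounded′ with All.++⁻ cu bounded
  ... | bu , by ∷ bx ∷ _ ∷ bv = All.++⁺ (bounded-recolour C D cu bx by bu) (bx ∷ bx ∷ by ∷ bv)
  D≢C : D ≢ C
  D≢C = suc≢ (c≢d ∘ sym)
  oldC : Increasing (cls C cu ++ x ∷ z ∷ cls C cv)
  oldC with windowClass cu m cv valid c
  ... | old rewrite pick-no C y D≢C | pick-yes C x | pick-yes C z = old
  oldD : Increasing (cls D cu ++ y ∷ cls D cv)
  oldD with windowClass cu m cv valid d
  ... | old rewrite pick-yes D y | pick-no D x (D≢C ∘ sym) | pick-no D z (D≢C ∘ sym) = old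
  classes : ∀ j → Increasing (cls (suc j) (recolour C D cu) ++ cls (suc j) m′ ++ cls (suc j) cv)
  classes j rewrite cls-recolour C D (suc j) cu with j ≟ c | j ≟ d
  ... | yes refl | yes refl = ⊥-elim (c≢d refl)
  ... | yes refl | no _ rewrite exchange-left C D | pick-yes C y | pick-yes C z | pick-no C x D≢C
    with inc-mid⁻ (cls C cu) oldC | inc-mid⁻ (cls D cu) oldD
  ... | _ , _ , _ , (z<v ∷ inc-v) | inc-u , u<y , _ , _ =
    inc-mid⁺ inc-u u<y (y<z ∷ above-trans y<z z<v) (z<v ∷ inc-v)
  classes j | no _ | yes refl rewrite exchange-right C D | pick-no D y (D≢C ∘ sym)
                                    | pick-no D z (D≢C ∘ sym) | pick-yes D x
    with inc-mid⁻ (cls C cu) oldC | inc-mid⁻ (cls D cu) oldD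
  ... | inc-u , u<x , _ , _ | _ , _ , y<v , inc-v =
    inc-mid⁺ inc-u u<x (above-trans x<y y<v) inc-v
  classes j | no j≢c | no j≢d
    rewrite exchange-other (suc≢ j≢c) (suc≢ j≢d) | pick-no (suc j) y (suc≢ (j≢c ∘ sym))
          | pick-no (suc j) z (suc≢ (j≢c ∘ sym)) | pick-no (suc j) x (suc≢ (j≢d ∘ sym))
    with windowClass cu m cv valid j
  ... | old rewrite pick-no (suc j) y (suc≢ (j≢d ∘ sym)) | pick-no (suc j) x (suc≢ (j≢c ∘ sym))
                  | pick-no (suc j) z (suc≢ (j≢c ∘ sym)) = old

coverable-knuth₁ : ∀ {k s} u v {x y z} → x < y → y < z →
  Coverable k (u ++ x ∷ z ∷ y ∷ v) s → Coverable k (u ++ z ∷ x ∷ y ∷ v) s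
coverable-knuth₁ u v {x} {y} {z} x<y y<z (cw , e , valid , s≤w)
  with splitWindow u (x ∷ z ∷ y ∷ []) v cw e
... | cu , (_ , c₁) ∷ (_ , c₂) ∷ (_ , c₃) ∷ [] , cv , refl , refl , refl , refl
  with apart? c₁ c₂
... | inj₁ apart =
  covering cu ((z , c₂) ∷ (x , c₁) ∷ (y , c₃) ∷ []) cv (swap-apart cu _ _ _ apart valid)
    (reweigh cu cv (weight-swap (x , c₁) (z , c₂) _) s≤w)
... | inj₂ (c , refl , refl) with c₃
...   | zero = covering cu _ cv (knuth₁-unselected cu cv c x<y y<z valid) (reweigh cu cv refl s≤w)
...   | suc d with d ≟ c
...     | yes refl = ⊥-elim (inversion-apart (cu ++ (x , suc c) ∷ []) [] cv
                       (subst (IsColouring _) (snoc-assoc cu _ _) valid) y<z c refl refl)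
...     | no d≢c =
  subst (λ w → Coverable _ (letters cu ++ z ∷ x ∷ y ∷ w) _) (letters-recolour _ _ cv)
    (covering cu _ (recolour (suc c) (suc d) cv) (knuth₁-exchange cu cv c d x<y y<z (d≢c ∘ sym) valid)
      (reweigh-suffix cu cv c d refl s≤w))

coverable-knuth₂ : ∀ {k s} u v {x y z} → x < y → y < z →
  Coverable k (u ++ y ∷ x ∷ z ∷ v) s → Coverable k (u ++ y ∷ z ∷ x ∷ v) s
coverable-knuth₂ u v {x} {y} {z} x<y y<z (cw , e , valid , s≤w)
  with splitWindow u (y ∷ x ∷ z ∷ []) v cw e
... | cu , (_ , c₁) ∷ (_ , c₂) ∷ (_ , c₃) ∷ [] , cv , refl , refl , refl , refl
  with apart? c₂ c₃
... | inj₁ apart =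
  covering cu ((y , c₁) ∷ (z , c₃) ∷ (x , c₂) ∷ []) cv
    (subst (IsColouring _) (sym (snoc-assoc cu _ _))
      (swap-apart (cu ++ (y , c₁) ∷ []) _ _ cv apart (subst (IsColouring _) (snoc-assoc cu _ _) valid)))
    (reweigh cu cv (weight-cons (y , c₁) (weight-swap (x , c₂) (z , c₃) [])) s≤w)
... | inj₂ (c , refl , refl) with c₁
...   | zero = covering cu _ cv (knuth₂-unselected cu cv c x<y y<z valid) (reweigh cu cv refl s≤w)
...   | suc d with d ≟ c
...     | yes refl = ⊥-elim (inversion-apart cu [] ((z , suc c) ∷ cv) valid x<y c refl refl)
...     | no d≢c =
  subst (λ w → Coverable _ (w ++ y ∷ z ∷ x ∷ letters cv) _) (letters-recolour _ _ cu)
    (covering (recolour (suc c) (suc d) cu) _ cv (knuth₂-exchange cu cv c d x<y y<z (d≢c ∘ sym) valid)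
      (reweigh-prefix cu cv c d refl s≤w))

infix 4 _≈ᴷ_

data _≈ᴷ_ : List ℕ → List ℕ → Set where
  ≈ᴷ-refl  : ∀ {w} → w ≈ᴷ w
  ≈ᴷ-sym   : ∀ {w w′} → w ≈ᴷ w′ → w′ ≈ᴷ w
  ≈ᴷ-trans : ∀ {w₁ w₂ w₃} → w₁ ≈ᴷ w₂ → w₂ ≈ᴷ w₃ → w₁ ≈ᴷ w₃
  knuth₁   : ∀ u v {x y z} → x < y → y < z → u ++ x ∷ z ∷ y ∷ v ≈ᴷ u ++ z ∷ x ∷ y ∷ v
  knuth₂   : ∀ u v {x y z} → x < y → y < z → u ++ y ∷ x ∷ z ∷ v ≈ᴷ u ++ y ∷ z ∷ x ∷ v

≈ᴷ-prefix : ∀ p {w w′} → w ≈ᴷ w′ → p ++ w ≈ᴷ p ++ w′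
≈ᴷ-prefix p ≈ᴷ-refl          = ≈ᴷ-refl
≈ᴷ-prefix p (≈ᴷ-sym q)       = ≈ᴷ-sym (≈ᴷ-prefix p q)
≈ᴷ-prefix p (≈ᴷ-trans q r)   = ≈ᴷ-trans (≈ᴷ-prefix p q) (≈ᴷ-prefix p r)
≈ᴷ-prefix p (knuth₁ u v x<y y<z) =
  subst₂ _≈ᴷ_ (++-assoc p u _) (++-assoc p u _) (knuth₁ (p ++ u) v x<y y<z)
≈ᴷ-prefix p (knuth₂ u v x<y y<z) =
  subst₂ _≈ᴷ_ (++-assoc p u _) (++-assoc p u _) (knuth₂ (p ++ u) v x<y y<z)
≈ᴷ-suffix : ∀ q {w w′} → w ≈ᴷ w′ → w ++ q ≈ᴷ w′ ++ q
≈ᴷ-suffix q ≈ᴷ-refl        = ≈ᴷ-refl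
≈ᴷ-suffix q (≈ᴷ-sym p)     = ≈ᴷ-sym (≈ᴷ-suffix q p)
≈ᴷ-suffix q (≈ᴷ-trans p r) = ≈ᴷ-trans (≈ᴷ-suffix q p) (≈ᴷ-suffix q r)
≈ᴷ-suffix q (knuth₁ u v x<y y<z) =
  subst₂ _≈ᴷ_ (sym (++-assoc u _ q)) (sym (++-assoc u _ q)) (knuth₁ u (v ++ q) x<y y<z)
≈ᴷ-suffix q (knuth₂ u v x<y y<z) =
  subst₂ _≈ᴷ_ (sym (++-assoc u _ q)) (sym (++-assoc u _ q)) (knuth₂ u (v ++ q) x<y y<z)

≈ᴷ-reflexive : ∀ {w w′} → w ≡ w′ → w ≈ᴷ w′
≈ᴷ-reflexive refl = ≈ᴷ-refl

coverable-≈ᴷ : ∀ {w w′} → w ≈ᴷ w′ → ∀ k s → Coverable k w s ⇔ Coverable k w′ s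
coverable-≈ᴷ ≈ᴷ-refl        k s = ⇔-id _
coverable-≈ᴷ (≈ᴷ-sym p)     k s = ⇔-sym (coverable-≈ᴷ p k s)
coverable-≈ᴷ (≈ᴷ-trans p q) k s = coverable-≈ᴷ q k s ⇔-∘ coverable-≈ᴷ p k s
coverable-≈ᴷ (knuth₁ u v {y = y} x<y y<z) k s =
  mk⇔ (coverable-knuth₁ u v x<y y<z) (coverable-sort u (y ∷ v) (<-trans x<y y<z))
coverable-≈ᴷ (knuth₂ u v {x} {y} {z} x<y y<z) k s =
  mk⇔ (coverable-knuth₂ u v x<y y<z) λ cov →
    subst (λ w → Coverable k w s) (++-assoc u (y ∷ []) (x ∷ z ∷ v))
      (coverable-sort (u ++ y ∷ []) v (<-trans x<y y<z)
        (subst (λ w → Coverable k w s) (snoc-assoc u y (z ∷ x ∷ v)) cov))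

unique-swap : ∀ u {a b v} → Unique (u ++ a ∷ b ∷ v) → Unique (u ++ b ∷ a ∷ v)
unique-swap []      ((a≢b ∷ a∉v) ∷ b∉v ∷ uv) = ((a≢b ∘ sym) ∷ b∉v) ∷ a∉v ∷ uv
unique-swap (c ∷ u) (c∉ ∷ uv)                = swap-all u c∉ ∷ unique-swap u uv
  where
  swap-all : ∀ {P : ℕ → Set} u {a b v} → All P (u ++ a ∷ b ∷ v) → All P (u ++ b ∷ a ∷ v)
  swap-all []      (pa ∷ pb ∷ pv) = pb ∷ pa ∷ pv
  swap-all (c ∷ u) (pc ∷ pu)      = pc ∷ swap-all u pu

unique-≈ᴷ : ∀ {w w′} → w ≈ᴷ w′ → Unique w ⇔ Unique w′
unique-≈ᴷ ≈ᴷ-refl        = ⇔-id _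
unique-≈ᴷ (≈ᴷ-sym p)     = ⇔-sym (unique-≈ᴷ p)
unique-≈ᴷ (≈ᴷ-trans p q) = unique-≈ᴷ q ⇔-∘ unique-≈ᴷ p
unique-≈ᴷ (knuth₁ u v _ _) = mk⇔ (unique-swap u) (unique-swap u)
unique-≈ᴷ (knuth₂ u v _ _) = mk⇔ shift shift
  where
  shift : ∀ {a b c} → Unique (u ++ a ∷ b ∷ c ∷ v) → Unique (u ++ a ∷ c ∷ b ∷ v)
  shift {a} uq = subst Unique (++-assoc u (a ∷ []) _)
    (unique-swap (u ++ a ∷ []) (subst Unique (snoc-assoc u a _) uq))

data RowInsert (x : ℕ) : List ℕ → List ℕ → ℕ ⊎ Bool → Set where
  appended : RowInsert x [] (x ∷ []) (inj₂ true)
  bumped   : ∀ {y ys} → x < y → RowInsert x (y ∷ ys) (x ∷ ys) (inj₁ y)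
  passed   : ∀ {y ys ys′ res} → y ≤ x → RowInsert x ys ys′ res →
             RowInsert x (y ∷ ys) (y ∷ ys′) res

rowInsert-view : ∀ x r → RowInsert x r (proj₁ (rowInsert x r)) (proj₂ (rowInsert x r))
rowInsert-view x []       = appended
rowInsert-view x (y ∷ ys) with suc x ≤ᵇ y in x<ᵇy
... | true  = bumped (≤ᵇ⇒≤ (suc x) y (subst T (sym x<ᵇy) tt))
... | false with rowInsert x ys | rowInsert-view x ys
...   | _ , _ | view = passed (≮⇒≥ λ x<y → subst T x<ᵇy (≤⇒≤ᵇ x<y)) view

rowInsert-all : ∀ {P : ℕ → Set} {x r r′ res} → RowInsert x r r′ res → All P r → P x → All P r′
rowInsert-all appended       _          px = px ∷ []
rowInsert-all (bumped _)     (_ ∷ ps)   px = px ∷ ps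
rowInsert-all (passed _ ins) (py ∷ ps) px = py ∷ rowInsert-all ins ps px

rowInsert-bumped : ∀ {x r r′ z} → RowInsert x r r′ (inj₁ z) → z ∈ r × x < z
rowInsert-bumped (bumped x<y)   = here refl , x<y
rowInsert-bumped (passed _ ins) with rowInsert-bumped ins
... | z∈r , x<z = there z∈r , x<z
bumped-greater : ∀ {x r r′ z} → RowInsert x r r′ (inj₁ z) → x < z
bumped-greater ins = proj₂ (rowInsert-bumped ins)

rowInsert-head : ∀ {x r r′ res} → RowInsert x r r′ res → Σ ℕ λ c → Σ (List ℕ) λ t → r′ ≡ c ∷ t × c ≤ x
rowInsert-head appended       = _ , _ , refl , ≤-refl
rowInsert-head (bumped _)     = _ , _ , refl , ≤-refl
rowInsert-head (passed y≤x _) = _ , _ , refl , y≤x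

rowInsert-appended : ∀ {x r r′ b} → RowInsert x r r′ (inj₂ b) → r′ ≡ r ++ x ∷ []
rowInsert-appended appended       = refl
rowInsert-appended (passed _ ins) = cong (_ ∷_) (rowInsert-appended ins)

rowInsert-increasing : ∀ {x r r′ res} → RowInsert x r r′ res → Increasing r → All (_≢ x) r → Increasing r′
rowInsert-increasing appended       _            _          = [] ∷ []
rowInsert-increasing (bumped x<y)   (y<ys ∷ inc) _          = above-trans x<y y<ys ∷ inc
rowInsert-increasing (passed y≤x ins) (y<ys ∷ inc) (y≢x ∷ fresh) =
  rowInsert-all ins y<ys (≤∧≢⇒< y≤x y≢x) ∷ rowInsert-increasing ins inc fresh

move-to-second : ∀ a v x → x < a → Increasing (a ∷ v) → a ∷ v ++ x ∷ [] ≈ᴷ a ∷ x ∷ v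
move-to-second a []      x x<a _ = ≈ᴷ-refl
move-to-second a (b ∷ v) x x<a ((a<b ∷ _) ∷ inc) =
  ≈ᴷ-trans (≈ᴷ-prefix (a ∷ []) (move-to-second b v x (<-trans x<a a<b) inc)) (≈ᴷ-sym (knuth₂ [] v x<a a<b))

rowInsert-≈ᴷ : ∀ {x r r′ z} → RowInsert x r r′ (inj₁ z) → Increasing r → All (_≢ x) r → r ++ x ∷ [] ≈ᴷ z ∷ r′
rowInsert-≈ᴷ (bumped {y} {ys} x<y) inc _ = move-to-second y ys _ x<y inc
rowInsert-≈ᴷ (passed {y} y≤x ins) (y<ys ∷ inc) (y≢x ∷ fresh) with rowInsert-head ins
... | c , t , refl , c≤x =
  ≈ᴷ-trans (≈ᴷ-prefix (y ∷ []) (rowInsert-≈ᴷ ins inc fresh))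
           (knuth₁ [] t y<c (≤-<-trans c≤x (bumped-greater ins)))
  where
  y<c : y < c
  y<c = All.head (rowInsert-all ins y<ys (≤∧≢⇒< y≤x y≢x))

read : Tableau → List ℕ
read []      = []
read (r ∷ T) = read T ++ r

-- Below r s: row s may sit directly under row r in a tableau, i.e. it is
-- no longer and each of its entries exceeds the entry of r above it.
Below : List ℕ → List ℕ → Set
Below r       []      = ⊤
Below []      (b ∷ s) = ⊥
Below (a ∷ r) (b ∷ s) = a < b × Below r s

BelowHead : List ℕ → Tableau → Set
BelowHead r []      = ⊤
BelowHead r (s ∷ _) = Below r s

IsTableau : Tableau → Set
IsTableau []      = ⊤
IsTableau (r ∷ T) = Increasing r × BelowHead r T × IsTableau T

below-appended : ∀ {x r r′ b s} → RowInsert x r r′ (inj₂ b) → Below r s → Below r′ s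
below-appended {s = []}    _              _               = tt
below-appended {s = _ ∷ _} (passed _ ins) (a<b , below) = a<b , below-appended ins below
below-bumped : ∀ {x r r′ z s} → RowInsert x r r′ (inj₁ z) → Below r s → Below r′ s
below-bumped {s = []}    _              _                = tt
below-bumped {s = _ ∷ _} (bumped x<y)   (y<b , below)  = <-trans x<y y<b , below
below-bumped {s = _ ∷ _} (passed _ ins) (a<b , below)  = a<b , below-bumped ins below

below-cascade : ∀ {x r r′ z s s′ res} → RowInsert x r r′ (inj₁ z) → RowInsert z s s′ res →
  Below r s → Below r′ s′
below-cascade (bumped x<y)     appended      _              = x<y , tt
below-cascade (bumped x<y)     (bumped _)    (_ , below)    = x<y , below
below-cascade (bumped _)       (passed b≤y _) (y<b , _)     = ⊥-elim (<⇒≱ y<b b≤y)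
below-cascade (passed y≤x ins) appended      _              = ≤-<-trans y≤x (bumped-greater ins) , tt
below-cascade (passed y≤x ins) (bumped _)    (_ , below)    =
  ≤-<-trans y≤x (bumped-greater ins) , below-bumped ins below
below-cascade (passed _ ins)   (passed _ ins′) (a<b , below) = a<b , below-cascade ins ins′ below

belowHead-cascade : ∀ {x r r′ z} rows → RowInsert x r r′ (inj₁ z) → BelowHead r rows →
  BelowHead r′ (insertT z rows)
belowHead-cascade [] ins _ with rowInsert-head ins
... | c , t , refl , c≤x = ≤-<-trans c≤x (bumped-greater ins) , tt
belowHead-cascade {z = z} (s ∷ rows) ins below with rowInsert z s | rowInsert-view z s
... | s′ , inj₁ _ | ins′ = below-cascade ins ins′ below
... | s′ , inj₂ _ | ins′ = below-cascade ins ins′ below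

belowHead-appended : ∀ {x r r′ b} rows → RowInsert x r r′ (inj₂ b) → BelowHead r rows → BelowHead r′ rows
belowHead-appended []      _   _     = tt
belowHead-appended (_ ∷ _) ins below = below-appended ins below

fresh-in-row : ∀ rows r x → Unique ((read rows ++ r) ++ x ∷ []) → All (_≢ x) r
fresh-in-row rows r x u with allPairs-++⁻ (read rows ++ r) u
... | _ , _ , cross = All.map All.head (All.++⁻ʳ (read rows) cross)

bumped-fresh : ∀ {x r r′ z} rows → RowInsert x r r′ (inj₁ z) →
  Unique ((read rows ++ r) ++ x ∷ []) → Unique (read rows ++ z ∷ [])
bumped-fresh {r = r} rows ins u with allPairs-++⁻ (read rows ++ r) u
... | u′ , _ , _ with allPairs-++⁻ (read rows) u′
... | u-rows , _ , cross =
  AllPairs.++⁺ u-rows ([] ∷ []) (All.map (λ a∉r → All.lookup a∉r z∈r ∷ []) cross)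
  where
  z∈r = proj₁ (rowInsert-bumped ins)

insert-isTableau : ∀ x T → IsTableau T → Unique (read T ++ x ∷ []) → IsTableau (insertT x T)
insert-isTableau x []         _                     _ = ([] ∷ []) , tt , tt
insert-isTableau x (r ∷ rows) (inc , below , tab) u with rowInsert x r | rowInsert-view x r
... | _ , inj₁ z | ins = rowInsert-increasing ins inc (fresh-in-row rows r x u) ,
                         belowHead-cascade rows ins below ,
                         insert-isTableau z rows tab (bumped-fresh rows ins u)
... | _ , inj₂ _ | ins = rowInsert-increasing ins inc (fresh-in-row rows r x u) ,
                         belowHead-appended rows ins below , tab

insert-reading : ∀ x T → IsTableau T → Unique (read T ++ x ∷ []) → read (insertT x T) ≈ᴷ read T ++ x ∷ []
insert-reading x []         _                 _ = ≈ᴷ-refl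
insert-reading x (r ∷ rows) (inc , _ , tab) u with rowInsert x r | rowInsert-view x r
... | r′ , inj₁ z | ins =
  ≈ᴷ-trans (≈ᴷ-suffix r′ (insert-reading z rows tab (bumped-fresh rows ins u)))
  (≈ᴷ-trans (≈ᴷ-reflexive (++-assoc (read rows) (z ∷ []) r′))
  (≈ᴷ-trans (≈ᴷ-prefix (read rows) (≈ᴷ-sym (rowInsert-≈ᴷ ins inc (fresh-in-row rows r x u))))
            (≈ᴷ-reflexive (sym (++-assoc (read rows) r (x ∷ []))))))
... | r′ , inj₂ _ | ins =
  ≈ᴷ-reflexive (trans (cong (read rows ++_) (rowInsert-appended ins)) (sym (++-assoc (read rows) r (x ∷ []))))

insert-all : ∀ T p w → IsTableau T → read T ≈ᴷ p → Unique (p ++ w) →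
  IsTableau (foldl (λ T x → insertT x T) T w) × read (foldl (λ T x → insertT x T) T w) ≈ᴷ p ++ w
insert-all T p []      tab T≈p _ = tab , ≈ᴷ-trans T≈p (≈ᴷ-reflexive (sym (++-identityʳ p)))
insert-all T p (x ∷ w) tab T≈p u
  with insert-all (insertT x T) (p ++ x ∷ []) w
         (insert-isTableau x T tab uT) (≈ᴷ-trans (insert-reading x T tab uT) (≈ᴷ-suffix (x ∷ []) T≈p))
         (subst Unique (snoc-assoc p x w) u)
  where
  uT : Unique (read T ++ x ∷ [])
  uT = Equivalence.from (unique-≈ᴷ (≈ᴷ-suffix (x ∷ []) T≈p))
         (proj₁ (allPairs-++⁻ (p ++ x ∷ []) (subst Unique (snoc-assoc p x w) u)))
... | tab′ , reading = tab′ , ≈ᴷ-trans reading (≈ᴷ-reflexive (sym (snoc-assoc p x w)))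

insertionTableau-spec : ∀ w → Unique w → IsTableau (insertionTableau w) × read (insertionTableau w) ≈ᴷ w
insertionTableau-spec w = insert-all [] [] w tt ≈ᴷ-refl

Λ : ℕ → List ℕ → ℕ
Λ k la = sum (take k la)

paint : ℕ → List ℕ → Coloured
paint c = map (_, c)
letters-paint : ∀ c r → letters (paint c r) ≡ r
letters-paint c []      = refl
letters-paint c (a ∷ r) = cong (a ∷_) (letters-paint c r)
cls-paint-same : ∀ j r → cls j (paint j r) ≡ r
cls-paint-same j []      = refl
cls-paint-same j (a ∷ r) = cong₂ _++_ (pick-yes j a) (cls-paint-same j r)
cls-paint-other : ∀ j {c} r → c ≢ j → cls j (paint c r) ≡ []
cls-paint-other j []      c≢j = refl
cls-paint-other j (a ∷ r) c≢j = cong₂ _++_ (pick-no j a c≢j) (cls-paint-other j r c≢j)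
weight-paint : ∀ c r → weight (paint (suc c) r) ≡ length r
weight-paint c []      = refl
weight-paint c (a ∷ r) = cong suc (weight-paint c r)
weight-unselected : ∀ r → weight (paint 0 r) ≡ 0
weight-unselected []      = refl
weight-unselected (a ∷ r) = weight-unselected r

byRows : ℕ → ℕ → Tableau → Coloured
byRows c m       []      = []
byRows c zero    (r ∷ T) = byRows c zero T ++ paint 0 r
byRows c (suc m) (r ∷ T) = byRows (suc c) m T ++ paint (suc c) r

letters-byRows : ∀ c m T → letters (byRows c m T) ≡ read T
letters-byRows c m       []      = refl
letters-byRows c zero    (r ∷ T) =
  trans (map-++ proj₁ (byRows c zero T) _) (cong₂ _++_ (letters-byRows c zero T) (letters-paint 0 r))
letters-byRows c (suc m) (r ∷ T) =
  trans (map-++ proj₁ (byRows (suc c) m T) _) (cong₂ _++_ (letters-byRows (suc c) m T) (letters-paint (suc c) r))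
weight-byRows : ∀ c m T → weight (byRows c m T) ≡ Λ m (map length T)
weight-byRows c zero    []      = refl
weight-byRows c (suc m) []      = refl
weight-byRows c zero    (r ∷ T) =
  trans (weight-++ (byRows c zero T) _) (cong₂ _+_ (weight-byRows c zero T) (weight-unselected r))
weight-byRows c (suc m) (r ∷ T) =
  trans (weight-++ (byRows (suc c) m T) _)
    (trans (cong₂ _+_ (weight-byRows (suc c) m T) (weight-paint c r)) (+-comm _ (length r)))
bounded-byRows : ∀ {k} c m T → c + m ≤ k → All (λ e → proj₂ e ≤ k) (byRows c m T)
bounded-byRows c m       []      _   = []
bounded-byRows c zero    (r ∷ T) c≤k =
  All.++⁺ (bounded-byRows c zero T c≤k) (All.map⁺ (All.universal (λ _ → z≤n) r))
bounded-byRows {k} c (suc m) (r ∷ T) c+m≤k =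
  All.++⁺ (bounded-byRows (suc c) m T c+1+m≤k) (All.map⁺ (All.universal (λ _ → ≤-trans (s≤s (m≤m+n c m)) c+1+m≤k) r))
  where
  c+1+m≤k : suc c + m ≤ k
  c+1+m≤k = subst (_≤ k) (+-suc c m) c+m≤k

cls-byRows-low : ∀ c m T j → j < c → cls (suc j) (byRows c m T) ≡ []
cls-byRows-low c m       []      j j<c = refl
cls-byRows-low c zero    (r ∷ T) j j<c =
  trans (cls-++ (suc j) (byRows c zero T) _) (cong₂ _++_ (cls-byRows-low c zero T j j<c) (cls-paint-other (suc j) r λ ()))
cls-byRows-low c (suc m) (r ∷ T) j j<c =
  trans (cls-++ (suc j) (byRows (suc c) m T) _)
    (cong₂ _++_ (cls-byRows-low (suc c) m T j (m≤n⇒m≤1+n j<c)) (cls-paint-other (suc j) r (λ e → <-irrefl (sym (suc-injective e)) j<c)))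

-- Each colour class of byRows c m T is empty or a single row of T.
increasing-byRows : ∀ c m T → All Increasing T → ∀ j → Increasing (cls (suc j) (byRows c m T))
increasing-byRows c m [] _ j = []
increasing-byRows c zero (r ∷ T) (_ ∷ incs) j
  rewrite cls-++ (suc j) (byRows c zero T) (paint 0 r) | cls-paint-other (suc j) {0} r (λ ())
        | ++-identityʳ (cls (suc j) (byRows c zero T)) = increasing-byRows c zero T incs j
increasing-byRows c (suc m) (r ∷ T) (inc ∷ incs) j
  rewrite cls-++ (suc j) (byRows (suc c) m T) (paint (suc c) r) with j ≟ c
... | yes refl rewrite cls-byRows-low (suc c) m T c ≤-refl | cls-paint-same (suc c) r = inc
... | no j≢c rewrite cls-paint-other (suc j) r (suc≢ (j≢c ∘ sym)) | ++-identityʳ (cls (suc j) (byRows (suc c) m T)) =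
  increasing-byRows (suc c) m T incs j

rows-increasing : ∀ T → IsTableau T → All Increasing T
rows-increasing []      _               = []
rows-increasing (r ∷ T) (inc , _ , tab) = inc ∷ rows-increasing T tab

greene-lower : ∀ k T → IsTableau T → Coverable k (read T) (Λ k (map length T))
greene-lower k T tab =
  byRows 0 k T , letters-byRows 0 k T ,
  (bounded-byRows 0 k T ≤-refl , increasing-byRows 0 k T (rows-increasing T tab)) ,
  ≤-reflexive (sym (weight-byRows 0 k T))

count : ℕ → Coloured → ℕ
count zero    cw = 0
count (suc k) cw = length (cls (suc k) cw) + count k cw

count-++ : ∀ k cw cw′ → count k (cw ++ cw′) ≡ count k cw + count k cw′
count-++ zero    cw cw′ = refl
count-++ (suc k) cw cw′ = begin
  length (cls (suc k) (cw ++ cw′)) + count k (cw ++ cw′)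
    ≡⟨ cong₂ _+_ (trans (cong length (cls-++ (suc k) cw cw′)) (length-++ (cls (suc k) cw))) (count-++ k cw cw′) ⟩
  (length (cls (suc k) cw) + length (cls (suc k) cw′)) + (count k cw + count k cw′)
    ≡⟨ interchange (length (cls (suc k) cw)) (length (cls (suc k) cw′)) (count k cw) (count k cw′) ⟩
  count (suc k) cw + count (suc k) cw′ ∎
  where open ≡-Reasoning
count-above : ∀ k a c → k < c → count k ((a , c) ∷ []) ≡ 0
count-above zero    a c k<c = refl
count-above (suc k) a c k<c
  rewrite pick-no (suc k) a (λ c≡k → <-irrefl (sym c≡k) k<c) = count-above k a c (<-trans (n<1+n k) k<c)
count-single : ∀ k a c → c ≤ k → count k ((a , c) ∷ []) ≡ weight ((a , c) ∷ [])
count-single zero    a zero    _   = refl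
count-single (suc k) a c       c≤k with c ≟ suc k
... | yes refl = cong suc (count-above k a (suc k) ≤-refl)
... | no  c≢k  = count-single k a c (≤-pred (≤∧≢⇒< c≤k c≢k))

weight-count : ∀ k cw → All (λ e → proj₂ e ≤ k) cw → weight cw ≡ count k cw
weight-count k []             _           = sym (count-empty k)
  where
  count-empty : ∀ k → count k [] ≡ 0
  count-empty zero    = refl
  count-empty (suc k) = count-empty k
weight-count k ((a , c) ∷ cw) (c≤k ∷ bs) = begin
  weight ((a , c) ∷ cw)                      ≡⟨ weight-++ ((a , c) ∷ []) cw ⟩
  weight ((a , c) ∷ []) + weight cw          ≡⟨ cong₂ _+_ (sym (count-single k a c c≤k)) (weight-count k cw bs) ⟩
  count k ((a , c) ∷ []) + count k cw        ≡⟨ count-++ k ((a , c) ∷ []) cw ⟨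
  count k ((a , c) ∷ cw)                     ∎
  where open ≡-Reasoning

decreasing-weight : ∀ k cw → IsColouring k cw → Decreasing (letters cw) → weight cw ≤ k
decreasing-weight k cw (bounded , inc) dec =
  subst (_≤ k) (sym (weight-count k cw bounded)) (count≤ k)
  where
  count≤ : ∀ k′ → count k′ cw ≤ k′
  count≤ zero     = z≤n
  count≤ (suc k′) = +-mono-≤ (monotone-both _ (inc k′) (cls-allPairs (suc k′) cw dec)) (count≤ k′)

interleaving-all : ∀ {X : Set} {P : X → Set} {a b w} → Interleaving a b w → All P w → All P a
interleaving-all []          []         = []
interleaving-all (consˡ sp) (pe ∷ ps) = pe ∷ interleaving-all sp ps
interleaving-all (consʳ sp) (_ ∷ ps)  = interleaving-all sp ps
interleaving-allPairs : ∀ {R : ℕ → ℕ → Set} {a b w} → Interleaving a b w → AllPairs R w → AllPairs R a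
interleaving-allPairs []          []         = []
interleaving-allPairs (consˡ sp) (re ∷ rs) = interleaving-all sp re ∷ interleaving-allPairs sp rs
interleaving-allPairs (consʳ sp) (_ ∷ rs)  = interleaving-allPairs sp rs
interleaving-cls : ∀ j {a b w} → Interleaving a b w → Interleaving (cls j a) (cls j b) (cls j w)
interleaving-cls j [] = []
interleaving-cls j {(x , c) ∷ _} (consˡ sp) with c ≟ j
... | yes _ = consˡ (interleaving-cls j sp)
... | no  _ = interleaving-cls j sp
interleaving-cls j {b = (x , c) ∷ _} (consʳ sp) with c ≟ j
... | yes _ = consʳ (interleaving-cls j sp)
... | no  _ = interleaving-cls j sp
interleaving-colouring : ∀ {k a b w} → Interleaving a b w → IsColouring k w → IsColouring k a
interleaving-colouring sp (bounded , inc) =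
  interleaving-all sp bounded , λ j → interleaving-allPairs (interleaving-cls (suc j) sp) (inc j)
interleaving-weight : ∀ {a b w} → Interleaving a b w → weight w ≡ weight a + weight b
interleaving-weight [] = refl
interleaving-weight {(_ , zero)  ∷ _} (consˡ sp) = interleaving-weight sp
interleaving-weight {(_ , suc _) ∷ _} (consˡ sp) = cong suc (interleaving-weight sp)
interleaving-weight {b = (_ , zero) ∷ _} (consʳ sp) = interleaving-weight sp
interleaving-weight {a} {(_ , suc _) ∷ b} (consʳ sp) =
  trans (cong suc (interleaving-weight sp)) (sym (+-suc (weight a) (weight b)))

firstColumn : Tableau → List ℕ
firstColumn []      = []
firstColumn (r ∷ T) = firstColumn T ++ take 1 r
dropColumn : Tableau → Tableau
dropColumn = map (drop 1)

splitRow : ∀ (cr : Coloured) → Interleaving (drop 1 cr) (take 1 cr) cr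
splitRow []       = []
splitRow (e ∷ cr) = consʳ (allLeft cr)
  where
  allLeft : ∀ (cr : Coloured) → Interleaving cr [] cr
  allLeft []       = []
  allLeft (e ∷ cr) = consˡ (allLeft cr)

peelColumn : ∀ T cw → letters cw ≡ read T →
  Σ Coloured λ ca → Σ Coloured λ cb →
    letters ca ≡ read (dropColumn T) × letters cb ≡ firstColumn T × Interleaving ca cb cw
peelColumn []      []  refl = [] , [] , refl , refl , []
peelColumn (r ∷ T) cw e with split (read T) cw e
... | cT , cr , refl , lT , refl with peelColumn T cT lT
... | ca , cb , la , lb , sp =
  ca ++ drop 1 cr , cb ++ take 1 cr ,
  trans (map-++ proj₁ ca _) (cong₂ _++_ la (sym (drop-map 1 cr))) ,
  trans (map-++ proj₁ cb _) (cong₂ _++_ lb (sym (take-map 1 cr))) ,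
  Interleaving.++⁺ sp (splitRow cr)

below-empty : ∀ T → IsTableau T → BelowHead [] T → firstColumn T ≡ []
below-empty []             _               _  = refl
below-empty ([] ∷ T)       (_ , below , tab) _ = cong (_++ []) (below-empty T tab below)
below-empty ((_ ∷ _) ∷ T) _                ()

column-above : ∀ a r T → IsTableau T → BelowHead (a ∷ r) T → All (a <_) (firstColumn T)
column-above a r []             _                  _           = []
column-above a r ([] ∷ T)       (_ , below , tab) _           rewrite below-empty T tab below = []
column-above a r ((b ∷ s) ∷ T) (_ , below , tab) (a<b , _) =
  All.++⁺ (above-trans a<b (column-above b s T tab below)) (a<b ∷ [])

column-decreasing : ∀ T → IsTableau T → Decreasing (firstColumn T)
column-decreasing []             _                  = []
column-decreasing ([] ∷ T)       (_ , below , tab) rewrite below-empty T tab below = []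
column-decreasing ((a ∷ r) ∷ T) (_ , below , tab) =
  AllPairs.++⁺ (column-decreasing T tab) ([] ∷ []) (All.map (_∷ []) (column-above a r T tab below))

nonEmptyRows : ℕ → Tableau → ℕ
nonEmptyRows k T = Λ k (map (length ∘ take 1) T)

Λ-peel : ∀ k T → Λ k (map length T) ≡ Λ k (map length (dropColumn T)) + nonEmptyRows k T
Λ-peel zero    T              = refl
Λ-peel (suc k) []             = refl
Λ-peel (suc k) ([] ∷ T)       = Λ-peel k T
Λ-peel (suc k) ((a ∷ r) ∷ T) = begin
  suc (length r + Λ k (map length T))
    ≡⟨ cong (λ n → suc (length r + n)) (Λ-peel k T) ⟩
  suc (length r + (Λ k (map length (dropColumn T)) + nonEmptyRows k T))
    ≡⟨ cong suc (+-assoc (length r) _ _) ⟨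
  suc (length r + Λ k (map length (dropColumn T)) + nonEmptyRows k T)
    ≡⟨ +-suc _ _ ⟨
  length r + Λ k (map length (dropColumn T)) + suc (nonEmptyRows k T) ∎
  where open ≡-Reasoning

column-bound : ∀ k T → IsTableau T → ∀ s → s ≤ k → s ≤ length (firstColumn T) → s ≤ nonEmptyRows k T
column-bound k       T                _                 zero    _         _ = z≤n
column-bound (suc k) []               _                 (suc s) _         ()
column-bound (suc k) ([] ∷ T)         (_ , below , tab) (suc s) _         s<col
  rewrite below-empty T tab below with s<col
... | ()
column-bound (suc k) ((a ∷ r) ∷ T) (_ , _ , tab) (suc s) (s≤s s≤k) s<col =
  s≤s (column-bound k T tab s s≤k
        (≤-pred (subst (suc s ≤_) (trans (length-++ (firstColumn T)) (+-comm _ 1)) s<col)))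

tableau-dropColumn : ∀ T → IsTableau T → IsTableau (dropColumn T)
tableau-dropColumn []      _                   = tt
tableau-dropColumn (r ∷ T) (inc , below , tab) =
  AllPairs.drop⁺ 1 inc , belowHead-drop r T below , tableau-dropColumn T tab
  where
  below-drop : ∀ r s → Below r s → Below (drop 1 r) (drop 1 s)
  below-drop r       []      _           = tt
  below-drop (a ∷ r) (b ∷ s) (_ , below) = below
  belowHead-drop : ∀ r T → BelowHead r T → BelowHead (drop 1 r) (dropColumn T)
  belowHead-drop r []      _     = tt
  belowHead-drop r (s ∷ T) below = below-drop r s below

-- Bounded row lengths, the measure for peeling columns one by one: it
-- drops when a column is removed, vanishes only on empty tableaux, and
-- starts at the length of the reading word.
RowsAtMost : ℕ → Tableau → Set
RowsAtMost N = All (λ r → length r ≤ N)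
rowsAtMost-drop : ∀ N T → RowsAtMost (suc N) T → RowsAtMost N (dropColumn T)
rowsAtMost-drop N []             _                  = []
rowsAtMost-drop N ([] ∷ T)       (_ ∷ bounds)       = z≤n ∷ rowsAtMost-drop N T bounds
rowsAtMost-drop N ((a ∷ r) ∷ T) (s≤s r≤N ∷ bounds) = r≤N ∷ rowsAtMost-drop N T bounds
read-empty : ∀ T → RowsAtMost 0 T → read T ≡ []
read-empty []             _              = refl
read-empty ([] ∷ T)       (_ ∷ bounds)   = trans (++-identityʳ (read T)) (read-empty T bounds)
read-empty ((a ∷ r) ∷ T) (() ∷ _)
rowsAtMost-read : ∀ T → RowsAtMost (length (read T)) T
rowsAtMost-read []      = []
rowsAtMost-read (r ∷ T) =
  subst (length r ≤_) (sym (length-++ (read T))) (m≤n+m (length r) (length (read T))) ∷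
  All.map (λ r′≤ → ≤-trans r′≤ (subst (length (read T) ≤_) (sym (length-++ (read T))) (m≤m+n _ _)))
          (rowsAtMost-read T)

-- Greene's theorem for tableaux, upper bound, by peeling off the first
-- column: it contributes at most min(k, its length) selected letters.
greene-upper-peeling : ∀ N T → RowsAtMost N T → IsTableau T →
  ∀ k cw → letters cw ≡ read T → IsColouring k cw → weight cw ≤ Λ k (map length T)
greene-upper-peeling zero T bounds tab k [] e valid = z≤n
greene-upper-peeling zero T bounds tab k (_ ∷ _) e valid with trans e (read-empty T bounds)
... | ()
greene-upper-peeling (suc N) T bounds tab k cw e valid with peelColumn T cw e
... | ca , cb , la , lb , sp = begin
  weight cw                                                   ≡⟨ interleaving-weight sp ⟩
  weight ca + weight cb                                       ≤⟨ +-mono-≤ rest column ⟩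
  Λ k (map length (dropColumn T)) + nonEmptyRows k T          ≡⟨ Λ-peel k T ⟨
  Λ k (map length T)                                          ∎
  where
  open ≤-Reasoning
  rest : weight ca ≤ Λ k (map length (dropColumn T))
  rest = greene-upper-peeling N (dropColumn T) (rowsAtMost-drop N T bounds) (tableau-dropColumn T tab)
           k ca la (interleaving-colouring sp valid)
  column : weight cb ≤ nonEmptyRows k T
  column = column-bound k T tab (weight cb)
    (decreasing-weight k cb (interleaving-colouring (swap sp) valid)
       (subst Decreasing (sym lb) (column-decreasing T tab)))
    (subst (weight cb ≤_) (cong length lb) (weight≤length cb))

greene-upper : ∀ k T → IsTableau T → ∀ s → Coverable k (read T) s → s ≤ Λ k (map length T)
greene-upper k T tab s (cw , e , valid , s≤w) =
  ≤-trans s≤w (greene-upper-peeling (length (read T)) T (rowsAtMost-read T) tab k cw e valid)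

shapeOf : List ℕ → List ℕ
shapeOf w = map length (insertionTableau w)

greene-attained : ∀ k w → Unique w → Coverable k w (Λ k (shapeOf w))
greene-attained k w u with insertionTableau-spec w u
... | tab , reading = Equivalence.to (coverable-≈ᴷ reading k _) (greene-lower k _ tab)
greene-maximal : ∀ k w s → Unique w → Coverable k w s → s ≤ Λ k (shapeOf w)
greene-maximal k w s u cov with insertionTableau-spec w u
... | tab , reading = greene-upper k _ tab s (Equivalence.from (coverable-≈ᴷ reading k s) cov)

Adjacent : ℕ → ℕ → Set
Adjacent p q = q ≡ suc p ⊎ p ≡ suc q
Avoids : ℕ → ℕ → ℕ → Set
Avoids p q e = e ≢ p × e ≢ q

adjacent-sym : ∀ {p q} → Adjacent p q → Adjacent q p
adjacent-sym (inj₁ e) = inj₂ e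
adjacent-sym (inj₂ e) = inj₁ e
avoids-sym : ∀ {p q e} → Avoids p q e → Avoids q p e
avoids-sym (e≢p , e≢q) = e≢q , e≢p

adjacent-below : ∀ {p q e} → Adjacent p q → Avoids p q e → e < p → e < q
adjacent-below (inj₁ refl) _         e<p       = m<n⇒m<1+n e<p
adjacent-below (inj₂ refl) (_ , e≢q) (s≤s e≤q) = ≤∧≢⇒< e≤q e≢q
adjacent-above : ∀ {p q e} → Adjacent p q → Avoids p q e → p < e → q < e
adjacent-above (inj₁ refl) (_ , e≢q) p<e = ≤∧≢⇒< p<e (e≢q ∘ sym)
adjacent-above (inj₂ refl) _         p<e = <-trans (n<1+n _) p<e

inc-replace : ∀ us {vs p q} → Adjacent p q → All (Avoids p q) us → All (Avoids p q) vs →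
  Increasing (us ++ p ∷ vs) → Increasing (us ++ q ∷ vs)
inc-replace us adj avoid-us avoid-vs inc with inc-mid⁻ us inc
... | inc-us , us<p , p<vs , inc-vs =
  inc-mid⁺ inc-us (All.zipWith (uncurry (adjacent-below adj)) (avoid-us , us<p))
                  (All.zipWith (uncurry (adjacent-above adj)) (avoid-vs , p<vs)) inc-vs

exchange-valid : ∀ {k} cu cm cv {p q c₁ c₂} → Adjacent p q → Apart c₁ c₂ →
  All (Avoids p q) (letters cu) → All (Avoids p q) (letters cm) → All (Avoids p q) (letters cv) →
  IsColouring k (cu ++ (p , c₁) ∷ cm ++ (q , c₂) ∷ cv) →
  IsColouring k (cu ++ (q , c₁) ∷ cm ++ (p , c₂) ∷ cv)
exchange-valid cu cm cv {p} {q} {c₁} {c₂} adj apart au am av (bounded , inc) = bounded′ , classes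
  where
  bounded′ : All _ (cu ++ (q , c₁) ∷ cm ++ (p , c₂) ∷ cv)
  bounded′ with All.++⁻ cu bounded
  ... | bu , b₁ ∷ rest with All.++⁻ cm rest
  ... | bm , b₂ ∷ bv = All.++⁺ bu (b₁ ∷ All.++⁺ bm (b₂ ∷ bv))
  classes : ∀ j → Increasing (cls (suc j) (cu ++ (q , c₁) ∷ cm ++ (p , c₂) ∷ cv))
  classes j rewrite cls-two (suc j) cu (q , c₁) cm (p , c₂) cv with inc j
  ... | old rewrite cls-two (suc j) cu (p , c₁) cm (q , c₂) cv with c₁ ≟ suc j | c₂ ≟ suc j
  ... | yes e₁   | yes e₂   = ⊥-elim (apart j e₁ e₂)
  ... | yes refl | no _     = inc-replace U adj aU (All.++⁺ aM aV) old
    where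
    U = cls (suc j) cu
    aU = cls-all (suc j) cu au ; aM = cls-all (suc j) cm am ; aV = cls-all (suc j) cv av
  ... | no _     | yes refl =
    subst Increasing (++-assoc U M (p ∷ V))
      (inc-replace (U ++ M) (adjacent-sym adj) (All.map avoids-sym (All.++⁺ aU aM)) (All.map avoids-sym aV)
        (subst Increasing (sym (++-assoc U M (q ∷ V))) old))
    where
    U = cls (suc j) cu ; M = cls (suc j) cm ; V = cls (suc j) cv
    aU = cls-all (suc j) cu au ; aM = cls-all (suc j) cm am ; aV = cls-all (suc j) cv av
  ... | no _     | no _     = old

unselect-valid : ∀ {k} cu {a c} cv → IsColouring k (cu ++ (a , c) ∷ cv) → IsColouring k (cu ++ (a , 0) ∷ cv)
unselect-valid cu {a} {c} cv (bounded , inc) = bounded′ , classes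
  where
  bounded′ : All _ (cu ++ (a , 0) ∷ cv)
  bounded′ with All.++⁻ cu bounded
  ... | bu , _ ∷ bv = All.++⁺ bu (z≤n ∷ bv)
  classes : ∀ j → Increasing (cls (suc j) (cu ++ (a , 0) ∷ cv))
  classes j rewrite cls-++ (suc j) cu ((a , 0) ∷ cv) with inc j
  ... | old rewrite cls-++ (suc j) cu ((a , c) ∷ cv) with c ≟ suc j
  ... | yes refl = inc-delete (cls (suc j) cu) old
  ... | no _     = old

coverable-exchange-inversion : ∀ {k s} u m v {p q} → Adjacent p q → q < p →
  All (Avoids p q) u → All (Avoids p q) m → All (Avoids p q) v →
  Coverable k (u ++ p ∷ m ++ q ∷ v) s → Coverable k (u ++ q ∷ m ++ p ∷ v) s
coverable-exchange-inversion u m v {p} {q} adj q<p au am av (cw , e , valid , s≤w)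
  with splitMarked u m v p q cw e
... | cu , c₁ , cm , c₂ , cv , refl , refl , refl , refl =
  cu ++ (q , c₁) ∷ cm ++ (p , c₂) ∷ cv , letters-marked cu cm cv q p c₁ c₂ ,
  exchange-valid cu cm cv adj (inversion-apart cu cm cv valid q<p) au am av valid ,
  subst (_ ≤_) (weight-relabel cu c₁ (weight-relabel cm c₂ refl)) s≤w

-- Exchanging two adjacent values loses at most one covered letter: if both
-- letters share a subsequence, drop the first one from it.
coverable-exchange : ∀ {k s} u m v {p q} → Adjacent p q →
  All (Avoids p q) u → All (Avoids p q) m → All (Avoids p q) v →
  Coverable k (u ++ p ∷ m ++ q ∷ v) (suc s) → Coverable k (u ++ q ∷ m ++ p ∷ v) s
coverable-exchange u m v {p} {q} adj au am av (cw , e , valid , s<w)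
  with splitMarked u m v p q cw e
... | cu , c₁ , cm , c₂ , cv , refl , refl , refl , refl with apart? c₁ c₂
... | inj₁ apart =
  cu ++ (q , c₁) ∷ cm ++ (p , c₂) ∷ cv , letters-marked cu cm cv q p c₁ c₂ ,
  exchange-valid cu cm cv adj apart au am av valid ,
  subst (_ ≤_) (weight-relabel cu c₁ (weight-relabel cm c₂ refl)) (≤-trans (n≤1+n _) s<w)
... | inj₂ (c , refl , refl) =
  cu ++ (q , 0) ∷ cm ++ (p , suc c) ∷ cv , letters-marked cu cm cv q p 0 (suc c) ,
  exchange-valid cu cm cv adj (λ _ ()) au am av (unselect-valid cu _ valid) ,
  subst (_ ≤_) (weight-relabel cu 0 (weight-relabel cm (suc c) refl))
    (≤-pred (subst (_ ≤_) (weight-unselect cu c _) s<w))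

avoids-marked : ∀ u m v p q → Unique (u ++ p ∷ m ++ q ∷ v) →
  All (Avoids p q) u × All (Avoids p q) m × All (Avoids p q) v
avoids-marked u m v p q uq with allPairs-++⁻ u uq
... | _ , (p∉ ∷ uq′) , u∉ with allPairs-++⁻ m uq′
... | _ , (q∉v ∷ _) , m∉ =
  All.map (λ a∉ → All.lookup a∉ (here refl) , All.lookup a∉ (there (∈-++⁺ʳ m (here refl)))) u∉ ,
  All.zipWith (λ (p≢a , a∉qv) → (p≢a ∘ sym) , All.head a∉qv) (All.++⁻ˡ m p∉ , m∉) ,
  All.zipWith (λ (p≢a , q≢a) → (p≢a ∘ sym) , (q≢a ∘ sym)) (All.tail (All.++⁻ʳ m p∉) , q∉v)

-- Exchanging the consecutive values x+1 and x of a repetition-free word,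
-- where x+1 comes first: by Greene's theorem Λ_k of the RSK shape does not
-- decrease and grows by at most one.
shape-exchange : ∀ u m v x → Unique (u ++ suc x ∷ m ++ x ∷ v) → Unique (u ++ x ∷ m ++ suc x ∷ v) → ∀ k →
  Λ k (shapeOf (u ++ suc x ∷ m ++ x ∷ v)) ≤ Λ k (shapeOf (u ++ x ∷ m ++ suc x ∷ v)) ×
  Λ k (shapeOf (u ++ x ∷ m ++ suc x ∷ v)) ≤ suc (Λ k (shapeOf (u ++ suc x ∷ m ++ x ∷ v)))
shape-exchange u m v x uH uL k with avoids-marked u m v (suc x) x uH
... | au , am , av =
  greene-maximal k L _ uL (coverable-exchange-inversion u m v (inj₂ refl) (n<1+n x) au am av (greene-attained k H uH)) ,
  at-most-one-more
  where
  H = u ++ suc x ∷ m ++ x ∷ v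
  L = u ++ x ∷ m ++ suc x ∷ v
  at-most-one-more : Λ k (shapeOf L) ≤ suc (Λ k (shapeOf H))
  at-most-one-more with Λ k (shapeOf L) | greene-attained k L uL
  ... | zero  | _   = z≤n
  ... | suc s | cov = s≤s (greene-maximal k H s uH
          (coverable-exchange u m v (inj₁ refl) (All.map avoids-sym au) (All.map avoids-sym am) (All.map avoids-sym av) cov))

-- BandExcess t λ μ: every band of rows [a, b) holds at most t more cells
-- of λ than of μ, i.e. Λ_b λ − Λ_a λ ≤ Λ_b μ − Λ_a μ + t.
BandExcess : ℕ → List ℕ → List ℕ → Set
BandExcess t la mu = ∀ a b → Λ b la + Λ a mu ≤ Λ b mu + Λ a la + t

excess-refl : ∀ la → BandExcess 0 la la
excess-refl la a b = ≤-reflexive (sym (+-identityʳ _))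
excess-trans : ∀ {la mu nu t₁ t₂} → BandExcess t₁ la mu → BandExcess t₂ mu nu → BandExcess (t₁ + t₂) la nu
excess-trans {la} {mu} {nu} {t₁} {t₂} e₁ e₂ a b =
  +-cancelˡ-≤ (Λ a mu + Λ b mu) _ _ (begin
    Λ a mu + Λ b mu + (Λ b la + Λ a nu)                    ≡⟨ rearrange₁ ⟩
    (Λ b la + Λ a mu) + (Λ b mu + Λ a nu)                  ≤⟨ +-mono-≤ (e₁ a b) (e₂ a b) ⟩
    (Λ b mu + Λ a la + t₁) + (Λ b nu + Λ a mu + t₂)        ≡⟨ rearrange₂ ⟩
    Λ a mu + Λ b mu + (Λ b nu + Λ a la + (t₁ + t₂))        ∎)
  where
  open ≤-Reasoning
  rearrange₁ : Λ a mu + Λ b mu + (Λ b la + Λ a nu) ≡ (Λ b la + Λ a mu) + (Λ b mu + Λ a nu)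
  rearrange₁ = solve 4 (λ A B C D → (A :+ B) :+ (C :+ D) := (C :+ A) :+ (B :+ D)) refl (Λ a mu) (Λ b mu) (Λ b la) (Λ a nu)
  rearrange₂ : (Λ b mu + Λ a la + t₁) + (Λ b nu + Λ a mu + t₂) ≡ Λ a mu + Λ b mu + (Λ b nu + Λ a la + (t₁ + t₂))
  rearrange₂ = solve 6 (λ A B C D E F → (A :+ B :+ C) :+ (D :+ E :+ F) := E :+ A :+ (D :+ B :+ (C :+ F))) refl
                 (Λ b mu) (Λ a la) t₁ (Λ b nu) (Λ a mu) t₂

excess-from-steps : ∀ la mu → (∀ k → Λ k la ≤ Λ k mu × Λ k mu ≤ suc (Λ k la)) →
  BandExcess 1 la mu × BandExcess 1 mu la
excess-from-steps la mu bounds = forward , backward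
  where
  forward : BandExcess 1 la mu
  forward a b = subst (Λ b la + Λ a mu ≤_) (trans (+-suc (Λ b mu) (Λ a la)) (+-comm 1 _))
                  (+-mono-≤ (proj₁ (bounds b)) (proj₂ (bounds a)))
  backward : BandExcess 1 mu la
  backward a b = subst (Λ b mu + Λ a la ≤_) (+-comm 1 (Λ b la + Λ a mu))
                   (+-mono-≤ (proj₂ (bounds b)) (proj₁ (bounds a)))

word-unique : ∀ {n} (π : Permutation′ n) → Unique (word π)
word-unique {n} π = Unique.map⁺ injective (Unique.allFin⁺ n)
  where
  injective : ∀ {a b} → toℕ (π ⟨$⟩ʳ a) ≡ toℕ (π ⟨$⟩ʳ b) → a ≡ b
  injective e = trans (sym (inverseˡ π)) (trans (cong (π ⟨$⟩ˡ_) (Fin.toℕ-injective e)) (inverseˡ π))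
word-∈ : ∀ {n} (π : Permutation′ n) (i : Fin n) → toℕ i ∈ word π
word-∈ π i = subst (_∈ word π) (cong toℕ (inverseʳ π)) (∈-map⁺ (λ k → toℕ (π ⟨$⟩ʳ k)) (∈-allFin (π ⟨$⟩ˡ i)))

word-≈ : ∀ {n} (π τ : Permutation′ n) → π ≈ τ → word π ≡ word τ
word-≈ {n} π τ π≈τ = map-cong (λ k → cong toℕ (π≈τ k)) (allFin n)

toℕ-transpose : ∀ {n} (i j v : Fin n) → toℕ (PermutationComponents.transpose i j v) ≡ exchange (toℕ i) (toℕ j) (toℕ v)
toℕ-transpose i j v with v Fin.≟ i
... | yes refl = sym (exchange-left (toℕ v) (toℕ j))
... | no v≢i with v Fin.≟ j
...   | yes refl = sym (exchange-right (toℕ i) (toℕ v))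
...   | no v≢j = sym (exchange-other (v≢i ∘ Fin.toℕ-injective) (v≢j ∘ Fin.toℕ-injective))
word-transpose : ∀ {n} (π : Permutation′ n) (i j : Fin n) →
  word (π ∘ₚ transpose i j) ≡ map (exchange (toℕ i) (toℕ j)) (word π)
word-transpose {n} π i j = trans (map-cong (λ k → toℕ-transpose i j (π ⟨$⟩ʳ k)) (allFin n)) (map-∘ (allFin n))

Marked : List ℕ → ℕ → ℕ → Set
Marked w p q = Σ (List ℕ) λ u → Σ (List ℕ) λ m → Σ (List ℕ) λ v → w ≡ u ++ p ∷ m ++ q ∷ v
marked : ∀ w {p q} → p ≢ q → p ∈ w → q ∈ w → Marked w p q ⊎ Marked w q p
marked (a ∷ w) p≢q (here refl) (here q≡a) = ⊥-elim (p≢q (sym q≡a))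
marked (a ∷ w) p≢q (here refl) (there q∈w) with ∈-∃++ q∈w
... | m , v , refl = inj₁ ([] , m , v , refl)
marked (a ∷ w) p≢q (there p∈w) (here refl) with ∈-∃++ p∈w
... | m , v , refl = inj₂ ([] , m , v , refl)
marked (a ∷ w) p≢q (there p∈w) (there q∈w) with marked w p≢q p∈w q∈w
... | inj₁ (u , m , v , refl) = inj₁ (a ∷ u , m , v , refl)
... | inj₂ (u , m , v , refl) = inj₂ (a ∷ u , m , v , refl)

exchange-marked : ∀ u m v {p q} a b → All (Avoids p q) u → All (Avoids p q) m → All (Avoids p q) v →
  map (exchange p q) (u ++ a ∷ m ++ b ∷ v) ≡ u ++ exchange p q a ∷ m ++ exchange p q b ∷ v
exchange-marked u m v {p} {q} a b au am av = begin
  map (exchange p q) (u ++ a ∷ m ++ b ∷ v)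
    ≡⟨ map-++ (exchange p q) u _ ⟩
  map (exchange p q) u ++ exchange p q a ∷ map (exchange p q) (m ++ b ∷ v)
    ≡⟨ cong₂ (λ U w → U ++ exchange p q a ∷ w) (fixed u au) (map-++ (exchange p q) m _) ⟩
  u ++ exchange p q a ∷ map (exchange p q) m ++ exchange p q b ∷ map (exchange p q) v
    ≡⟨ cong₂ (λ M V → u ++ exchange p q a ∷ M ++ exchange p q b ∷ V) (fixed m am) (fixed v av) ⟩
  u ++ exchange p q a ∷ m ++ exchange p q b ∷ v ∎
  where
  open ≡-Reasoning
  fixed : ∀ w → All (Avoids p q) w → map (exchange p q) w ≡ w
  fixed []      []                   = refl
  fixed (e ∷ w) ((e≢p , e≢q) ∷ avoid) = cong₂ _∷_ (exchange-other e≢p e≢q) (fixed w avoid)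

n≢1+n : ∀ n → n ≢ suc n
n≢1+n n e = <-irrefl e (n<1+n n)

word-exchange-excess : ∀ w x y → y ≡ suc x → Unique w → Unique (map (exchange x y) w) → x ∈ w → y ∈ w →
  BandExcess 1 (shapeOf w) (shapeOf (map (exchange x y) w)) ×
  BandExcess 1 (shapeOf (map (exchange x y) w)) (shapeOf w)
word-exchange-excess w x .(suc x) refl uw uw′ x∈w x+1∈w with marked w (n≢1+n x) x∈w x+1∈w
... | inj₁ (u , m , v , refl) with avoids-marked u m v x (suc x) uw
...   | au , am , av
  rewrite exchange-marked u m v x (suc x) au am av | exchange-left x (suc x) | exchange-right x (suc x) =
  ×-swap (excess-from-steps _ _ (shape-exchange u m v x uw′ uw))
word-exchange-excess w x .(suc x) refl uw uw′ x∈w x+1∈w | inj₂ (u , m , v , refl)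
  with avoids-marked u m v (suc x) x uw
...   | au , am , av
  rewrite exchange-marked u m v (suc x) x (All.map avoids-sym au) (All.map avoids-sym am) (All.map avoids-sym av)
        | exchange-left x (suc x) | exchange-right x (suc x) =
  excess-from-steps _ _ (shape-exchange u m v x uw uw′)

step-excess : ∀ {n} (π : Permutation′ n) (i j : Fin n) → toℕ j ≡ suc (toℕ i) →
  BandExcess 1 (shape π) (shape (π ∘ₚ transpose i j)) × BandExcess 1 (shape (π ∘ₚ transpose i j)) (shape π)
step-excess π i j j≡1+i =
  subst (λ w → BandExcess 1 (shape π) (shapeOf w) × BandExcess 1 (shapeOf w) (shape π))
    (sym (word-transpose π i j))
    (word-exchange-excess (word π) (toℕ i) (toℕ j) j≡1+i (word-unique π)
      (subst Unique (word-transpose π i j) (word-unique (π ∘ₚ transpose i j))) (word-∈ π i) (word-∈ π j))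

steps-excess : ∀ {n t} {π τ : Permutation′ n} → Steps t π τ →
  BandExcess t (shape π) (shape τ) × BandExcess t (shape τ) (shape π)
steps-excess {π = π} {τ} (done π≈τ) =
  subst (λ w → BandExcess 0 (shape π) (shapeOf w) × BandExcess 0 (shapeOf w) (shape π)) (word-≈ π τ π≈τ)
    (excess-refl (shape π) , excess-refl (shape π))
steps-excess {π = π} {τ} (step {m} i j j≡1+i rest) with step-excess π i j j≡1+i | steps-excess rest
... | forth , back | forth′ , back′ =
  excess-trans forth forth′ , subst (λ t → BandExcess t (shape τ) (shape π)) (+-comm m 1) (excess-trans back′ back)

rows : ℕ → ℕ → List ℕ
rows a N = applyUpTo (a +_) N

-- Λ_{k+1} λ = Λ_k λ + λ_{k+1} (rows indexed from 0 in Defs.part).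
Λ-suc : ∀ k L → Λ (suc k) L ≡ Λ k L + part L k
Λ-suc zero    []      = refl
Λ-suc zero    (x ∷ L) = +-identityʳ x
Λ-suc (suc k) []      = refl
Λ-suc (suc k) (x ∷ L) = trans (cong (x +_) (Λ-suc k L)) (sym (+-assoc x _ _))

Λ-band : ∀ L a N → Λ (a + N) L ≡ Λ a L + sum (map (part L) (rows a N))
Λ-band L a zero    = trans (cong (λ k → Λ k L) (+-identityʳ a)) (sym (+-identityʳ _))
Λ-band L a (suc N) = begin
  Λ (a + suc N) L                         ≡⟨ cong (λ k → Λ k L) (+-suc a N) ⟩
  Λ (suc (a + N)) L                       ≡⟨ Λ-suc (a + N) L ⟩
  Λ (a + N) L + last                      ≡⟨ cong (_+ last) (Λ-band L a N) ⟩
  Λ a L + band + last                     ≡⟨ +-assoc (Λ a L) band last ⟩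
  Λ a L + (band + last)                   ≡⟨ cong (Λ a L +_) extend ⟩
  Λ a L + sum (map (part L) (rows a (suc N))) ∎
  where
  open ≡-Reasoning
  band = sum (map (part L) (rows a N))
  last = part L (a + N)
  extend : band + last ≡ sum (map (part L) (rows a (suc N)))
  extend = begin
    band + last                                    ≡⟨ cong (band +_) (+-identityʳ last) ⟨
    band + sum (last ∷ [])                         ≡⟨ sum-++ (map (part L) (rows a N)) _ ⟨
    sum (map (part L) (rows a N) ++ last ∷ [])     ≡⟨ cong sum (map-++ (part L) (rows a N) _) ⟨
    sum (map (part L) (rows a N ++ a + N ∷ []))    ≡⟨ cong (sum ∘ map (part L)) (applyUpTo-∷ʳ (a +_) N) ⟩
    sum (map (part L) (rows a (suc N)))            ∎

sum-∸ : ∀ (f g : ℕ → ℕ) js → All (λ j → g j ≤ f j) js →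
  sum (map (λ j → f j ∸ g j) js) + sum (map g js) ≡ sum (map f js)
sum-∸ f g []       []           = refl
sum-∸ f g (j ∷ js) (g≤f ∷ dom) =
  trans (interchange (f j ∸ g j) (sum (map (λ j → f j ∸ g j) js)) (g j) (sum (map g js)))
        (cong₂ _+_ (m∸n+n≡m g≤f) (sum-∸ f g js dom))

length-cells : ∀ la mu js →
  length (concatMap (λ j → applyUpTo (λ k → (j , part mu j + k)) (part la j ∸ part mu j)) js)
    ≡ sum (map (λ j → part la j ∸ part mu j) js)
length-cells la mu []       = refl
length-cells la mu (j ∷ js) =
  trans (length-++ (applyUpTo _ (part la j ∸ part mu j)))
        (cong₂ _+_ (length-applyUpTo _ _) (length-cells la mu js))

band-bound : ∀ {t} la mu a N → All (λ j → part mu j ≤ part la j) (rows a N) → BandExcess t la mu →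
  sum (map (λ j → part la j ∸ part mu j) (rows a N)) ≤ t
band-bound {t} la mu a N dom excess = +-cancelˡ-≤ X D t (begin
  X + D                                ≡⟨ rearrange₁ ⟩
  Λ a la + (D + Sμ) + Λ a mu           ≡⟨ cong (λ s → Λ a la + s + Λ a mu) (sum-∸ (part la) (part mu) (rows a N) dom) ⟩
  Λ a la + Sλ + Λ a mu                 ≡⟨ cong (_+ Λ a mu) (Λ-band la a N) ⟨
  Λ (a + N) la + Λ a mu                ≤⟨ excess a (a + N) ⟩
  Λ (a + N) mu + Λ a la + t            ≡⟨ cong (λ s → s + Λ a la + t) (Λ-band mu a N) ⟩
  Λ a mu + Sμ + Λ a la + t             ≡⟨ rearrange₂ ⟩
  X + t                                ∎)
  where
  open ≤-Reasoning
  D  = sum (map (λ j → part la j ∸ part mu j) (rows a N))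
  Sλ = sum (map (part la) (rows a N))
  Sμ = sum (map (part mu) (rows a N))
  X  = Λ a la + Sμ + Λ a mu
  rearrange₁ : X + D ≡ Λ a la + (D + Sμ) + Λ a mu
  rearrange₁ = solve 4 (λ P Q R S → P :+ Q :+ R :+ S := P :+ (S :+ Q) :+ R) refl (Λ a la) Sμ (Λ a mu) D
  rearrange₂ : Λ a mu + Sμ + Λ a la + t ≡ X + t
  rearrange₂ = solve 4 (λ P Q R S → P :+ Q :+ R :+ S := R :+ Q :+ P :+ S) refl (Λ a mu) Sμ (Λ a la) t

block-bound : ∀ {n t} la mu a b → IsLBlock n la mu a b → BandExcess t la mu → length (cells la mu a b) ≤ t
block-bound la mu a b block excess =
  subst (_≤ _) (sym (length-cells la mu (rows a (b ∸ a))))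
    (band-bound la mu a (b ∸ a) dom excess)
  where
  open IsLBlock block
  dom : All (λ j → part mu j ≤ part la j) (rows a (b ∸ a))
  dom = All.applyUpTo⁺₁ (a +_) (b ∸ a) λ {i} i<N →
    dominate (a + i) (m≤m+n a i) (subst (a + i <_) (m+[n∸m]≡n a≤b) (+-monoʳ-< a i<N))

-- Proposition 3.5: a block B of (λ(π), λ(τ)) lies in a band of rows where
-- one shape dominates the other, and there the band excess, at most
-- d(π, τ) = t, counts exactly the cells of B.
proposition3p5 : ∀ (n : ℕ) (π τ : Permutation′ n) (t : ℕ) →
    Distance π τ t →
    ∀ (B : Block n (shape π) (shape τ)) → A B ≤ t
proposition3p5 n π τ t (steps , _) (lblock a b block) = block-bound _ _ a b block (proj₁ (steps-excess steps))
proposition3p5 n π τ t (steps , _) (mblock a b block) = block-bound _ _ a b block (proj₂ (steps-excess steps))
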